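{- Let $D$ be a semicomplete multipartite digraph or a quasi-transitive digraph. Then $D$ is a CKI-digraph if and only if $D\cong \overrightarrow{C}_3$ or $D\cong\overrightarrow{C}_{m}(1,\pm 2,\pm 3,\dots,\pm \lfloor \frac{m}{2} \rfloor )$ for some $m\ge4$.
   Context: Digraphs are finite, without loops or parallel arcs; both arcs $uv$ and $vu$ may be present. The underlying graph $G_D$ has vertex set $V(D)$, with $\{u,v\}$ an edge iff $uv\in A(D)$ or $vu\in A(D)$. $D$ is semicomplete multipartite if $G_D$ is a complete multipartite graph. $D$ is quasi-transitive if for every directed path $uvw$ (arcs $uv,vw$, distinct vertices) there is an arc between $u$ and $w$. A kernel is a set $S$ of vertices that is independent (no arc between two vertices of $S$) and absorbent (every vertex outside $S$ has an arc into $S$). $D$ is a CKI-digraph if $D$ has no kernel but every proper induced subdigraph has a kernel. For nonempty $J\subseteq\mathbb{Z}_m\setminus\{0\}$, $\overrightarrow{C}_m(J)$ has vertex set $\mathbb{Z}_m$ and arcs $(i,j)$ with $j-i\in J$; here $J=\{1\}\cup\{\pm k:2\le k\le\lfloor m/2\rfloor\}$. $\overrightarrow{C}_3$ is the directed $3$-cycle. -}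

module Defs where

open import Data.Nat using (ℕ; zero; suc; _+_; _∸_; _≤_; _≡ᵇ_; _≤ᵇ_; _/_; _%_)
open import Data.Bool using (Bool; true; false; _∧_; _∨_; not)
open import Data.Fin using (Fin; toℕ)
open import Data.Product using (Σ; ∃; _×_; _,_)
open import Data.Sum using (_⊎_)
open import Relation.Binary.PropositionalEquality using (_≡_; _≢_)
open import Relation.Nullary using (¬_)
open import Function.Bundles using (_↔_; Inverse; _⇔_)

-- A finite digraph on vertex set Fin n; arc u v = true iff uv is an arc.
-- (A Bool-valued relation: at most one arc uv, so no parallel arcs.)
record Digraph : Set where
  field
    n   : ℕ
    arc : Fin n → Fin n → Bool
open Digraph public

Loopless : Digraph → Set
Loopless D = ∀ v → arc D v v ≡ false

adj : (D : Digraph) → Fin (n D) → Fin (n D) → Bool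
adj D u v = arc D u v ∨ arc D v u

SemicompleteMultipartite : Digraph → Set
SemicompleteMultipartite D =
  Σ (Fin (n D) → ℕ) λ part →
    ∀ u v → (adj D u v ≡ true) ⇔ (part u ≢ part v)

QuasiTransitive : Digraph → Set
QuasiTransitive D =
  ∀ u v w → u ≢ v → v ≢ w → u ≢ w →
    arc D u v ≡ true → arc D v w ≡ true →
    (arc D u w ≡ true) ⊎ (arc D w u ≡ true)

-- Kernel of the induced subdigraph D[P] (P a vertex subset, as a
-- characteristic function): K ⊆ P, K independent, K absorbent in D[P].
KernelIn : (D : Digraph) → (Fin (n D) → Bool) → (Fin (n D) → Bool) → Set
KernelIn D P K =
  (∀ v → K v ≡ true → P v ≡ true) ×
  (∀ u v → K u ≡ true → K v ≡ true → arc D u v ≡ false) ×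
  (∀ u → P u ≡ true → K u ≡ false →
     ∃ λ v → (K v ≡ true) × (arc D u v ≡ true))

HasKernelIn : (D : Digraph) → (Fin (n D) → Bool) → Set
HasKernelIn D P = ∃ λ K → KernelIn D P K

HasKernel : Digraph → Set
HasKernel D = HasKernelIn D (λ _ → true)

CKI : Digraph → Set
CKI D =
  ¬ HasKernel D ×
  (∀ (P : Fin (n D) → Bool) → (∃ λ v → P v ≡ false) → HasKernelIn D P)

record _≅_ (D E : Digraph) : Set where
  field
    bij : Fin (n D) ↔ Fin (n E)
    pres : ∀ u v → arc D u v ≡ arc E (Inverse.to bij u) (Inverse.to bij v)

diffMod : (m : ℕ) → Fin m → Fin m → ℕ
diffMod zero () _
diffMod (suc k) i j = ((toℕ j + suc k) ∸ toℕ i) % suc k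

-- circulant digraph C_m(J), J ⊆ Z_m \ {0} given by a Bool predicate on
-- residues 0..m-1 (with J 0 = false for the sets used below)
Circulant : (m : ℕ) → (ℕ → Bool) → Digraph
Circulant m J = record { n = m ; arc = λ i j → J (diffMod m i j) }

C3 : Digraph
C3 = Circulant 3 (λ d → d ≡ᵇ 1)

-- J = {1} ∪ {±k : 2 ≤ k ≤ ⌊m/2⌋} as a subset of residues mod m
Jm : ℕ → ℕ → Bool
Jm m d = (d ≡ᵇ 1)
       ∨ ((2 ≤ᵇ d) ∧ (d ≤ᵇ m / 2))
       ∨ ((1 ≤ᵇ d) ∧ (2 ≤ᵇ (m ∸ d)) ∧ ((m ∸ d) ≤ᵇ m / 2))

Cm : ℕ → Digraph
Cm m = Circulant m (Jm m)

module Submission where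

-- Both directions pass through cycle complements: digraphs whose only
-- missing arcs are the loops and the arcs σ x → x of a cyclic permutation σ
-- of order at least three.  C₃ and Cₘ(1, ±2, …, ±⌊m/2⌋) are the cycle
-- complements of order 3 and m.
-- The theorem follows: CKI ⇒ cycle complement ⇒ ≅ C₃ or Cₘ, and conversely.

open import Defs
open import Data.Nat using (ℕ; zero; suc; _+_; _∸_; _≤_; _<_; z≤n; s≤s; _≡ᵇ_; _≤ᵇ_; _/_; _%_; _*_; _<?_)
  renaming (_≟_ to _≟ℕ_)
open import Data.Nat.Properties
  using (≤-refl; ≤-trans; ≤-antisym; n≤1+n; n<1+n; ≤-pred; <-irrefl; <-≤-trans; ≤-<-trans; <⇒≤; ≤-total; ≮⇒≥; ≰⇒>; ≤∧≢⇒<;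
         suc-injective; +-suc; +-identityʳ; m≤n+m; m∸n+n≡m; m+[n∸m]≡n; m+n∸n≡m; m∸n≤m; n∸n≡0;
         m<n⇒0<n∸m; n≢0⇒n>0; ∸-monoˡ-≤; ∸-monoʳ-<; ∸-cancelˡ-≡; +-∸-comm; [m+n]∸[m+o]≡n∸o;
         _≤?_; <-cmp; +-comm; +-mono-≤; ≤ᵇ⇒≤; *-comm; +-monoˡ-≤; +-monoʳ-≤; ≤⇒≤ᵇ; module ≤-Reasoning)
open import Data.Nat.DivMod using (m≡m%n+[m/n]*n; m/n*n≤m; [m+n]%n≡m%n; m<n⇒m%n≡m; m%n<n)
open import Data.Bool using (Bool; true; false; _∧_; _∨_; not)
import Data.Bool as Bool
open import Data.Bool.Properties using (T-≡)
open import Data.Fin as F using (Fin; toℕ)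
open import Data.Fin.Properties as FP using (toℕ-injective; toℕ<n; punchOut-injective; injective⇒≤)
open import Data.Fin.Subset using (∣_∣; _∈_) renaming (⊥ to ∅)
open import Data.Fin.Subset.Properties using (∣p∣≤n; p⊂q⇒∣p∣<∣q∣; ∉⊥; ∣⊥∣≡0)
open import Data.Vec using (tabulate)
open import Data.Vec.Properties using (lookup∘tabulate; lookup⇒[]=; []=⇒lookup)
open import Data.Product using (∃; ∃₂; _×_; _,_; proj₁; proj₂)
open import Data.Sum using (_⊎_; inj₁; inj₂)
open import Data.Empty using (⊥; ⊥-elim)
open import Data.Unit using (⊤; tt)
open import Relation.Binary.Definitions using (tri<; tri≈; tri>)
open import Relation.Binary.PropositionalEquality using (_≡_; _≢_; refl; sym; trans; cong; subst; module ≡-Reasoning)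
open import Relation.Nullary using (¬_; ¬?; Dec; yes; no; does)
open import Relation.Nullary.Decidable using (dec-true; dec-false)
open import Function.Bundles using (Inverse; Equivalence; _⇔_; _↔_; mk⇔; mk↔ₛ′)

bool-clash : ∀ {b} → b ≡ false → b ≡ true → ⊥
bool-clash refl ()

b-cases : (b : Bool) → (b ≡ true) ⊎ (b ≡ false)
b-cases true = inj₁ refl
b-cases false = inj₂ refl

∨-introˡ : ∀ {a b} → a ≡ true → (a ∨ b) ≡ true
∨-introˡ refl = refl

∨-introʳ : ∀ a {b} → b ≡ true → (a ∨ b) ≡ true
∨-introʳ true _ = refl
∨-introʳ false e = e

∨-elim : ∀ a {b} → (a ∨ b) ≡ true → (a ≡ true) ⊎ (b ≡ true)
∨-elim true _ = inj₁ refl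
∨-elim false e = inj₂ e

∨-false : ∀ a {b} → (a ∨ b) ≡ false → (a ≡ false) × (b ≡ false)
∨-false false e = refl , e

∧-intro : ∀ {a b} → a ≡ true → b ≡ true → (a ∧ b) ≡ true
∧-intro refl refl = refl

∧-elim : ∀ a {b} → (a ∧ b) ≡ true → (a ≡ true) × (b ≡ true)
∧-elim true e = refl , e

not-intro : ∀ {a} → a ≡ false → not a ≡ true
not-intro refl = refl

not-elim : ∀ a → not a ≡ true → a ≡ false
not-elim false _ = refl

not-false : ∀ a → not a ≡ false → a ≡ true
not-false true _ = refl

witness : ∀ {A : Set} (d : Dec A) → does d ≡ true → A
witness (yes a) _ = a

_==_ : ∀ {m} → Fin m → Fin m → Bool
i == j = does (i F.≟ j)

==-true : ∀ {m} {i j : Fin m} → (i == j) ≡ true → i ≡ j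
==-true {i = i} {j} = witness (i F.≟ j)

==-refl : ∀ {m} (i : Fin m) → (i == i) ≡ true
==-refl i = dec-true (i F.≟ i) refl

==-false : ∀ {m} {i j : Fin m} → i ≢ j → (i == j) ≡ false
==-false {i = i} {j} = dec-false (i F.≟ j)

==-false⁻ : ∀ {m} {i j : Fin m} → (i == j) ≡ false → i ≢ j
==-false⁻ {i = i} e refl = bool-clash e (==-refl i)

anyF : ∀ {m} → (Fin m → Bool) → Bool
anyF P = does (FP.any? (λ i → P i Bool.≟ true))

anyF-intro : ∀ {m} (P : Fin m → Bool) (i : Fin m) → P i ≡ true → anyF P ≡ true
anyF-intro P i e = dec-true (FP.any? (λ i → P i Bool.≟ true)) (i , e)

anyF-elim : ∀ {m} (P : Fin m → Bool) → anyF P ≡ true → ∃ λ i → P i ≡ true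
anyF-elim P = witness (FP.any? (λ i → P i Bool.≟ true))

_⊆B_ : ∀ {m} → (Fin m → Bool) → (Fin m → Bool) → Set
P ⊆B Q = ∀ i → P i ≡ true → Q i ≡ true

count : ∀ {m} → (Fin m → Bool) → ℕ
count P = ∣ tabulate P ∣

count≤ : ∀ {m} (P : Fin m → Bool) → count P ≤ m
count≤ P = ∣p∣≤n (tabulate P)

∈-tabulate : ∀ {m} (P : Fin m → Bool) {i} → P i ≡ true → i ∈ tabulate P
∈-tabulate P {i} e = lookup⇒[]= i (tabulate P) (trans (lookup∘tabulate P i) e)

∈-tabulate⁻ : ∀ {m} (P : Fin m → Bool) {i} → i ∈ tabulate P → P i ≡ true
∈-tabulate⁻ P {i} e = trans (sym (lookup∘tabulate P i)) ([]=⇒lookup e)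

count-strict : ∀ {m} (P Q : Fin m → Bool) → P ⊆B Q →
  (j : Fin m) → Q j ≡ true → P j ≡ false → count P < count Q
count-strict P Q P⊆Q j qj pj = p⊂q⇒∣p∣<∣q∣
  ( (λ {i} i∈P → ∈-tabulate Q (P⊆Q i (∈-tabulate⁻ P i∈P)))
  , j , ∈-tabulate Q qj , (λ j∈P → bool-clash pj (∈-tabulate⁻ P j∈P)))

count-pos : ∀ {m} (P : Fin m → Bool) (j : Fin m) → P j ≡ true → 0 < count P
count-pos {m} P j e = subst (_< count P) (∣⊥∣≡0 m)
  (p⊂q⇒∣p∣<∣q∣ ((λ x∈∅ → ⊥-elim (∉⊥ x∈∅)) , j , ∈-tabulate P e , ∉⊥))

-- An injective map from a finite set to itself is surjective
-- (otherwise it would inject Fin (suc m) into Fin m).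
inj⇒surj : ∀ {m} (f : Fin m → Fin m) → (∀ x y → f x ≡ f y → x ≡ y) → ∀ y → ∃ λ x → f x ≡ y
inj⇒surj {suc m} f inj y with FP.any? (λ x → f x F.≟ y)
... | yes hit = hit
... | no miss = ⊥-elim (<-irrefl refl (injective⇒≤ {f = g} g-inj))
  where
  y∉image : ∀ x → y ≢ f x
  y∉image x e = miss (x , sym e)
  g : Fin (suc m) → Fin m
  g x = F.punchOut (y∉image x)
  g-inj : ∀ {x z} → g x ≡ g z → x ≡ z
  g-inj {x} {z} e = inj x z (punchOut-injective (y∉image x) (y∉image z) e)

Hereditary : Digraph → Set
Hereditary D = ∀ (P : Fin (n D) → Bool) → (∃ λ v → P v ≡ false) → HasKernelIn D P

module KernelOf {D : Digraph} {P : Fin (n D) → Bool} (k : HasKernelIn D P) where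
  K : Fin (n D) → Bool
  K = proj₁ k

  K⊆P : ∀ v → K v ≡ true → P v ≡ true
  K⊆P = proj₁ (proj₂ k)

  independent : ∀ u v → K u ≡ true → K v ≡ true → arc D u v ≡ false
  independent = proj₁ (proj₂ (proj₂ k))

  absorbent : ∀ u → P u ≡ true → K u ≡ false → ∃ λ v → (K v ≡ true) × (arc D u v ≡ true)
  absorbent = proj₂ (proj₂ (proj₂ k))

kernel : (D : Digraph) (K : Fin (n D) → Bool) →
  (∀ u v → K u ≡ true → K v ≡ true → arc D u v ≡ false) →
  (∀ u → K u ≡ false → ∃ λ v → (K v ≡ true) × (arc D u v ≡ true)) →
  HasKernel D
kernel D K independent absorbent = K , (λ _ _ → refl) , independent , (λ u _ → absorbent u)

-- A digraph without kernel has a vertex (∅ is a kernel of the empty digraph).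
some-vertex : (D : Digraph) → ¬ HasKernel D → Fin (n D)
some-vertex D no-kernel with FP.any? {P = λ _ → ⊤} (λ _ → yes tt)
... | yes (v , _) = v
... | no none = ⊥-elim (no-kernel (kernel D (λ _ → false) (λ _ _ ()) (λ w _ → ⊥-elim (none (w , tt)))))

OutClosed : (D : Digraph) → (Fin (n D) → Bool) → Set
OutClosed D S = ∀ x y → S x ≡ true → arc D x y ≡ true → S y ≡ true

-- If all proper induced subdigraphs have kernels, a nonempty proper out-closed
-- set S gives a kernel of D: a kernel K₁ of D[S], together with a kernel K₂ of
-- the subdigraph induced by the vertices outside S not absorbed by K₁.
module ClosedSetKernel (D : Digraph) (H : Hereditary D) (S : Fin (n D) → Bool) (closed : OutClosed D S)
                       {u v : Fin (n D)} (su : S u ≡ true) (sv : S v ≡ false) where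
  private
    A = arc D

  open KernelOf (H S (v , sv))
    renaming (K to K₁; K⊆P to K₁⊆S; independent to K₁-independent; absorbent to K₁-absorbent)

  absorbed : Fin (n D) → Bool
  absorbed w = anyF (λ k → K₁ k ∧ A w k)

  T : Fin (n D) → Bool
  T w = not (S w) ∧ not (absorbed w)

  Tu : T u ≡ false
  Tu rewrite su = refl

  open KernelOf (H T (u , Tu))
    renaming (K to K₂; K⊆P to K₂⊆T; independent to K₂-independent; absorbent to K₂-absorbent)

  K : Fin (n D) → Bool
  K w = K₁ w ∨ K₂ w

  T⇒¬S : ∀ w → T w ≡ true → S w ≡ false
  T⇒¬S w e = not-elim (S w) (proj₁ (∧-elim (not (S w)) e))

  T⇒¬absorbed : ∀ w → T w ≡ true → absorbed w ≡ false
  T⇒¬absorbed w e = not-elim (absorbed w) (proj₂ (∧-elim (not (S w)) e))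

  -- no arc from K₁ ⊆ S to K₂, as S is out-closed
  no-arc₁₂ : ∀ x y → K₁ x ≡ true → K₂ y ≡ true → A x y ≡ false
  no-arc₁₂ x y kx ky with b-cases (A x y)
  ... | inj₂ q = q
  ... | inj₁ p = ⊥-elim (bool-clash (T⇒¬S y (K₂⊆T y ky)) (closed x y (K₁⊆S x kx) p))

  -- no arc from K₂ to K₁, as K₂ is not absorbed by K₁
  no-arc₂₁ : ∀ x y → K₂ x ≡ true → K₁ y ≡ true → A x y ≡ false
  no-arc₂₁ x y kx ky with b-cases (A x y)
  ... | inj₂ q = q
  ... | inj₁ p = ⊥-elim (bool-clash (T⇒¬absorbed x (K₂⊆T x kx))
                          (anyF-intro (λ k → K₁ k ∧ A x k) y (∧-intro ky p)))

  K-independent : ∀ x y → K x ≡ true → K y ≡ true → A x y ≡ false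
  K-independent x y kx ky with ∨-elim (K₁ x) kx | ∨-elim (K₁ y) ky
  ... | inj₁ a | inj₁ b = K₁-independent x y a b
  ... | inj₁ a | inj₂ b = no-arc₁₂ x y a b
  ... | inj₂ a | inj₁ b = no-arc₂₁ x y a b
  ... | inj₂ a | inj₂ b = K₂-independent x y a b

  -- vertices of S are absorbed by K₁, absorbed ones too, and the rest by K₂
  K-absorbent : ∀ w → K w ≡ false → ∃ λ z → (K z ≡ true) × (A w z ≡ true)
  K-absorbent w kw with ∨-false (K₁ w) kw | b-cases (S w) | b-cases (absorbed w)
  ... | k₁w , _ | inj₁ sw | _ with K₁-absorbent w sw k₁w
  ...   | z , kz , wz = z , ∨-introˡ kz , wz
  K-absorbent w kw | _ | inj₂ _ | inj₁ aw with anyF-elim (λ k → K₁ k ∧ A w k) aw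
  ...   | z , e = z , ∨-introˡ (proj₁ (∧-elim (K₁ z) e)) , proj₂ (∧-elim (K₁ z) e)
  K-absorbent w kw | _ , k₂w | inj₂ sw | inj₂ aw with K₂-absorbent w Tw k₂w
    where Tw : T w ≡ true
          Tw rewrite sw | aw = refl
  ...   | z , kz , wz = z , ∨-introʳ (K₁ z) kz , wz

closed-set-kernel : (D : Digraph) → Hereditary D → (S : Fin (n D) → Bool) → OutClosed D S →
  (u v : Fin (n D)) → S u ≡ true → S v ≡ false → HasKernel D
closed-set-kernel D H S closed u v su sv = kernel D K K-independent K-absorbent
  where open ClosedSetKernel D H S closed su sv

module Reach {m : ℕ} (E : Fin m → Fin m → Bool) (u : Fin m) where

  R : ℕ → Fin m → Bool
  R zero v = u == v
  R (suc i) v = R i v ∨ anyF (λ w → R i w ∧ E w v)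

  R-u : R 0 u ≡ true
  R-u = ==-refl u

  R-suc : ∀ i v → R i v ≡ true → R (suc i) v ≡ true
  R-suc i v e = ∨-introˡ e

  R-step : ∀ i w v → R i w ≡ true → E w v ≡ true → R (suc i) v ≡ true
  R-step i w v rw e = ∨-introʳ (R i v) (anyF-intro (λ w → R i w ∧ E w v) w (∧-intro rw e))

  R-back : ∀ i v → R (suc i) v ≡ true → (R i v ≡ true) ⊎ (∃ λ w → (R i w ≡ true) × (E w v ≡ true))
  R-back i v e with ∨-elim (R i v) e
  ... | inj₁ p = inj₁ p
  ... | inj₂ q with anyF-elim (λ w → R i w ∧ E w v) q
  ...   | w , r = inj₂ (w , ∧-elim (R i w) r)

  R-mono : ∀ i j v → i ≤ j → R i v ≡ true → R j v ≡ true
  R-mono i j v i≤j e = subst (λ k → R k v ≡ true) (m∸n+n≡m i≤j) (go (j ∸ i))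
    where
    go : ∀ d → R (d + i) v ≡ true
    go zero = e
    go (suc d) = R-suc (d + i) v (go d)

  Stable : ℕ → Set
  Stable i = ∀ v → R (suc i) v ≡ true → R i v ≡ true

  stable-suc : ∀ i → Stable i → Stable (suc i)
  stable-suc i st v e with R-back (suc i) v e
  ... | inj₁ p = p
  ... | inj₂ (w , rw , ew) = R-step i w v (st w rw) ew

  stable-≤ : ∀ i j → i ≤ j → Stable i → Stable j
  stable-≤ i j i≤j st = subst Stable (m∸n+n≡m i≤j) (go (j ∸ i))
    where
    go : ∀ d → Stable (d + i)
    go zero = st
    go (suc d) = stable-suc (d + i) (go d)

  stable-or-large : ∀ k → (∃ λ j → (j ≤ k) × Stable j) ⊎ (suc k ≤ count (R k))
  stable-or-large zero = inj₂ (count-pos (R 0) u R-u)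
  stable-or-large (suc k) with stable-or-large k
  ... | inj₁ (j , j≤k , st) = inj₁ (j , ≤-trans j≤k (n≤1+n k) , st)
  ... | inj₂ large with b-cases (anyF new)
    where
    new : Fin m → Bool
    new v = R (suc k) v ∧ not (R k v)
  ...   | inj₁ p with anyF-elim _ p
  ...     | v , e = inj₂ (≤-<-trans large (count-strict (R k) (R (suc k)) (R-suc k) v
                            (proj₁ (∧-elim (R (suc k) v) e))
                            (not-elim (R k v) (proj₂ (∧-elim (R (suc k) v) e)))))
  stable-or-large (suc k) | inj₂ _ | inj₂ q = inj₁ (k , n≤1+n k , st)
    where
    st : Stable k
    st v e with b-cases (R k v)
    ... | inj₁ p = p
    ... | inj₂ r = ⊥-elim (bool-clash q (anyF-intro (λ v → R (suc k) v ∧ not (R k v)) v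
                                          (∧-intro e (not-intro r))))

  -- By the pigeonhole bound count ≤ m, the process is stable at step m.
  stable-m : Stable m
  stable-m with stable-or-large m
  ... | inj₂ large = ⊥-elim (<-irrefl refl (<-≤-trans large (count≤ (R m))))
  ... | inj₁ (j , j≤m , st) = stable-≤ j m j≤m st

  Reachable : Fin m → Bool
  Reachable = R m

  Reachable-closed : ∀ w v → Reachable w ≡ true → E w v ≡ true → Reachable v ≡ true
  Reachable-closed w v rw e = stable-m v (R-step m w v rw e)

  R⇒Reachable : ∀ i v → R i v ≡ true → Reachable v ≡ true
  R⇒Reachable i v e with ≤-total i m
  ... | inj₁ i≤m = R-mono i m v i≤m e
  ... | inj₂ m≤i = down (i ∸ m) (subst (λ k → R k v ≡ true) (sym (m∸n+n≡m m≤i)) e)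
    where
    down : ∀ d → R (d + m) v ≡ true → R m v ≡ true
    down zero e = e
    down (suc d) e = down d (stable-≤ m (d + m) (m≤n+m m d) stable-m v e)

  Reachable-u : Reachable u ≡ true
  Reachable-u = R⇒Reachable 0 u R-u

-- A digraph without kernel all of whose proper induced subdigraphs have
-- kernels is strongly connected: the vertices reachable from u form an
-- out-closed set, which must be everything.
strongly-connected : (D : Digraph) → Hereditary D → ¬ HasKernel D →
  ∀ u v → Reach.Reachable (arc D) u v ≡ true
strongly-connected D H no-kernel u v with b-cases (Reachable v)
  where open Reach (arc D) u
... | inj₁ r = r
... | inj₂ r = ⊥-elim (no-kernel (closed-set-kernel D H Reachable Reachable-closed u v Reachable-u r))
  where open Reach (arc D) u

Adjacent : (D : Digraph) → Fin (n D) → Fin (n D) → Set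
Adjacent D x y = (arc D x y ≡ true) ⊎ (arc D y x ≡ true)

Semicomplete : Digraph → Set
Semicomplete D = ∀ u v → u ≢ v → Adjacent D u v

semicomplete-if : (D : Digraph) →
  (∀ u v → u ≢ v → arc D u v ≡ false → arc D v u ≡ false → ⊥) → Semicomplete D
semicomplete-if D no-gap u v u≢v with b-cases (arc D u v) | b-cases (arc D v u)
... | inj₁ p | _ = inj₁ p
... | inj₂ _ | inj₁ q = inj₂ q
... | inj₂ p | inj₂ q = ⊥-elim (no-gap u v u≢v p q)

module DeleteVertex (D : Digraph) (H : Hereditary D) (no-kernel : ¬ HasKernel D) where

  private
    Vx = Fin (n D)
    A = arc D

  others : Vx → Vx → Bool
  others v w = not (w == v)

  others-v : ∀ v → others v v ≡ false
  others-v v rewrite ==-refl v = refl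

  others-w : ∀ v w → w ≢ v → others v w ≡ true
  others-w v w w≢v rewrite ==-false w≢v = refl

  private
    module Kernel-without (v : Vx) = KernelOf (H (others v) (v , others-v v))

  K : Vx → Vx → Bool
  K v = Kernel-without.K v

  K-independent : ∀ v x y → K v x ≡ true → K v y ≡ true → A x y ≡ false
  K-independent v = Kernel-without.independent v

  K-absorbent : ∀ v w → w ≢ v → K v w ≡ false → ∃ λ z → (K v z ≡ true) × (A w z ≡ true)
  K-absorbent v w w≢v = Kernel-without.absorbent v w (others-w v w w≢v)

  K-≢ : ∀ v w → K v w ≡ true → w ≢ v
  K-≢ v w e refl = bool-clash (others-v v) (Kernel-without.K⊆P v v e)

  -- v has no arc into K v: otherwise K v would be a kernel of D.
  K-no-arc-from : ∀ v k → K v k ≡ true → A v k ≡ false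
  K-no-arc-from v k kk with b-cases (A v k)
  ... | inj₂ p = p
  ... | inj₁ p = ⊥-elim (no-kernel (kernel D (K v) (K-independent v) absorbent))
    where
    absorbent : ∀ w → K v w ≡ false → ∃ λ z → (K v z ≡ true) × (A w z ≡ true)
    absorbent w kw with w F.≟ v
    ... | yes refl = k , kk , p
    ... | no w≢v = K-absorbent v w w≢v kw

  K-nonempty : ∀ v w → w ≢ v → ∃ λ x → K v x ≡ true
  K-nonempty v w w≢v with b-cases (K v w)
  ... | inj₁ p = w , p
  ... | inj₂ p with K-absorbent v w w≢v p
  ...   | z , kz , _ = z , kz

-- Each K v is an
-- independent set, hence inside one part, and that part is distinct from the
-- part of v and contained in K v.  Picking r v ∈ K v, the map v ↦ part (r v)
-- is injective, so r is a bijection onto the vertices and no part can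
-- contain two vertices.

module MultipartiteCKI (D : Digraph) (smp : SemicompleteMultipartite D)
                       (H : Hereditary D) (no-kernel : ¬ HasKernel D) where
  open DeleteVertex D H no-kernel

  private
    Vx = Fin (n D)
    A = arc D
    part = proj₁ smp

  same-part : ∀ u v → A u v ≡ false → A v u ≡ false → part u ≡ part v
  same-part u v p q with part u ≟ℕ part v
  ... | yes e = e
  ... | no ne = ⊥-elim (bool-clash not-adjacent (Equivalence.from (proj₂ smp u v) ne))
    where not-adjacent : adj D u v ≡ false
          not-adjacent rewrite p | q = refl

  same-part⇒no-arc : ∀ u v → part u ≡ part v → A u v ≡ false
  same-part⇒no-arc u v e with b-cases (A u v)
  ... | inj₂ p = p
  ... | inj₁ p = ⊥-elim (Equivalence.to (proj₂ smp u v) (∨-introˡ p) e)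

  K-one-part : ∀ v x y → K v x ≡ true → K v y ≡ true → part x ≡ part y
  K-one-part v x y kx ky = same-part x y (K-independent v x y kx ky) (K-independent v y x ky kx)

  -- K v lies in a part other than that of v: otherwise K v ∪ {v} is a kernel.
  K-other-part : ∀ v x → K v x ≡ true → part v ≢ part x
  K-other-part v x kx e = no-kernel (kernel D K' independent absorbent)
    where
    K' : Vx → Bool
    K' w = K v w ∨ (w == v)
    is-v : ∀ w → K' w ≡ true → K v w ≡ false → w ≡ v
    is-v w e1 e2 with ∨-elim (K v w) e1
    ... | inj₁ p = ⊥-elim (bool-clash e2 p)
    ... | inj₂ p = ==-true p
    in-K' : ∀ w → K' w ≡ true → part w ≡ part x
    in-K' w kw with b-cases (K v w)
    ... | inj₁ p = K-one-part v w x p kx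
    ... | inj₂ p with is-v w kw p
    ...   | refl = e
    independent : ∀ y z → K' y ≡ true → K' z ≡ true → A y z ≡ false
    independent y z ky kz = same-part⇒no-arc y z (trans (in-K' y ky) (sym (in-K' z kz)))
    absorbent : ∀ w → K' w ≡ false → ∃ λ z → (K' z ≡ true) × (A w z ≡ true)
    absorbent w kw with ∨-false (K v w) kw
    ... | kvw , wv with K-absorbent v w (==-false⁻ wv) kvw
    ...   | z , kz , az = z , ∨-introˡ kz , az

  K-whole-part : ∀ v x w → K v x ≡ true → part w ≡ part x → K v w ≡ true
  K-whole-part v x w kx e with b-cases (K v w)
  ... | inj₁ p = p
  ... | inj₂ p with K-absorbent v w w≢v p
    where w≢v : w ≢ v
          w≢v refl = K-other-part v x kx e
  ...   | k , kk , wk = ⊥-elim (bool-clash (same-part⇒no-arc w k (trans e (K-one-part v x k kx kk))) wk)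

  module _ (a b : Vx) (a≢b : a ≢ b) where
    -- a representative of K v (nonempty since D has two vertices)
    r : Vx → Vx
    r v with a F.≟ v
    ... | yes refl = proj₁ (K-nonempty v b (λ e → a≢b (sym e)))
    ... | no a≢v = proj₁ (K-nonempty v a a≢v)

    r∈K : ∀ v → K v (r v) ≡ true
    r∈K v with a F.≟ v
    ... | yes refl = proj₂ (K-nonempty v b (λ e → a≢b (sym e)))
    ... | no a≢v = proj₂ (K-nonempty v a a≢v)

    part-r-injective : ∀ v w → part (r v) ≡ part (r w) → v ≡ w
    part-r-injective v w e with v F.≟ w
    ... | yes p = p
    ... | no v≢w with b-cases (K w v)
    ...   | inj₁ kv = ⊥-elim (K-other-part v (r v) (r∈K v) (trans (K-one-part w v (r w) kv (r∈K w)) (sym e)))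
    ...   | inj₂ kv with K-absorbent w v v≢w kv
    ...     | k , kk , vk = ⊥-elim (bool-clash (K-no-arc-from v k k∈Kv) vk)
      where k∈Kv = K-whole-part v (r v) k (r∈K v) (trans (K-one-part w k (r w) kk (r∈K w)) (sym e))

    distinct-parts : part a ≢ part b
    distinct-parts e with inj⇒surj r r-inj a | inj⇒surj r r-inj b
      where r-inj : ∀ x y → r x ≡ r y → x ≡ y
            r-inj x y eq = part-r-injective x y (cong part eq)
    ... | v₁ , e₁ | v₂ , e₂ with part-r-injective v₁ v₂ (trans (cong part e₁) (trans e (cong part (sym e₂))))
    ...   | refl = a≢b (trans (sym e₁) e₂)

  semicomplete : Semicomplete D
  semicomplete = semicomplete-if D (λ u v u≢v p q → distinct-parts u v u≢v (same-part u v p q))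

module QuasiTransitiveFacts (D : Digraph) (loopless : Loopless D) (qt : QuasiTransitive D) where

  Vx = Fin (n D)
  A : Vx → Vx → Bool
  A = arc D

  arc-≢ : ∀ {x y} → A x y ≡ true → x ≢ y
  arc-≢ {x} e refl = bool-clash (loopless x) e

  qt-path : ∀ {x y z} → A x y ≡ true → A y z ≡ true → x ≢ z → Adjacent D x z
  qt-path {x} {y} {z} e₁ e₂ x≢z = qt x y z (arc-≢ e₁) (arc-≢ e₂) x≢z e₁ e₂

  record NonAdjacent (a b : Vx) : Set where
    constructor nonadjacent
    field
      no-ab : A a b ≡ false
      no-ba : A b a ≡ false
      a≢b : a ≢ b
  open NonAdjacent public

  NonAdjacent-sym : ∀ {a b} → NonAdjacent a b → NonAdjacent b a
  NonAdjacent-sym (nonadjacent p q r) = nonadjacent q p (λ e → r (sym e))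

  no-2-path : ∀ {a b x} → NonAdjacent a b → A a x ≡ true → A x b ≡ true → ⊥
  no-2-path (nonadjacent p q r) e₁ e₂ with qt-path e₁ e₂ r
  ... | inj₁ s = bool-clash p s
  ... | inj₂ s = bool-clash q s

  same-in : ∀ {a b x} → NonAdjacent a b → Adjacent D x a → Adjacent D x b → A x a ≡ A x b
  same-in {a} {b} {x} nab xa xb with b-cases (A x a) | b-cases (A x b)
  ... | inj₁ p | inj₁ q = trans p (sym q)
  ... | inj₂ p | inj₂ q = trans p (sym q)
  ... | inj₁ p | inj₂ q = ⊥-elim (no-2-path (NonAdjacent-sym nab) (from-b xb) p)
    where from-b : Adjacent D x b → A b x ≡ true
          from-b (inj₁ s) = ⊥-elim (bool-clash q s)
          from-b (inj₂ s) = s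
  ... | inj₂ p | inj₁ q = ⊥-elim (no-2-path nab (from-a xa) q)
    where from-a : Adjacent D x a → A a x ≡ true
          from-a (inj₁ s) = ⊥-elim (bool-clash p s)
          from-a (inj₂ s) = s

  same-out : ∀ {a b x} → NonAdjacent a b → Adjacent D x a → Adjacent D x b → A a x ≡ A b x
  same-out {a} {b} {x} nab xa xb with b-cases (A a x) | b-cases (A b x)
  ... | inj₁ p | inj₁ q = trans p (sym q)
  ... | inj₂ p | inj₂ q = trans p (sym q)
  ... | inj₁ p | inj₂ q = ⊥-elim (no-2-path nab p (to-b xb))
    where to-b : Adjacent D x b → A x b ≡ true
          to-b (inj₁ s) = s
          to-b (inj₂ s) = ⊥-elim (bool-clash q s)
  ... | inj₂ p | inj₁ q = ⊥-elim (no-2-path (NonAdjacent-sym nab) q (to-a xa))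
    where to-a : Adjacent D x a → A x a ≡ true
          to-a (inj₁ s) = s
          to-a (inj₂ s) = ⊥-elim (bool-clash p s)

  module Distance (u : Vx) where
    open Reach A u public

    AtDistance : ℕ → Vx → Set
    AtDistance zero v = u ≡ v
    AtDistance (suc k) v = (R (suc k) v ≡ true) × (R k v ≡ false)

    AtDistance⇒R : ∀ k v → AtDistance k v → R k v ≡ true
    AtDistance⇒R zero v refl = R-u
    AtDistance⇒R (suc k) v (p , _) = p

    AtDistance-≢u : ∀ k v → AtDistance (suc k) v → u ≢ v
    AtDistance-≢u k v (_ , q) refl = bool-clash q (R-mono 0 k u z≤n R-u)

    distance : ∀ i v → R i v ≡ true → ∃ λ k → AtDistance k v
    distance zero v e = 0 , ==-true e
    distance (suc i) v e with b-cases (R i v)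
    ... | inj₁ p = distance i v p
    ... | inj₂ q = suc i , e , q

    predecessor : ∀ k v → AtDistance (suc k) v → ∃ λ w → AtDistance k w × (A w v ≡ true)
    predecessor zero v (p , q) with R-back zero v p
    ... | inj₁ r = ⊥-elim (bool-clash q r)
    ... | inj₂ (w , rw , e) = w , ==-true rw , e
    predecessor (suc j) v (p , q) with R-back (suc j) v p
    ... | inj₁ r = ⊥-elim (bool-clash q r)
    ... | inj₂ (w , rw , e) = w , (rw , not-earlier) , e
      where not-earlier : R j w ≡ false
            not-earlier with b-cases (R j w)
            ... | inj₂ s = s
            ... | inj₁ s = ⊥-elim (bool-clash q (R-step j w v s e))

    -- A vertex at distance k + 2 lies on a shortest path w' → w → v and, by
    -- quasi-transitivity, dominates w'.
    back-arc : ∀ k v → AtDistance (suc (suc k)) v →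
      ∃₂ λ w w' → (AtDistance (suc k) w × (A w v ≡ true)) × (AtDistance k w' × (A w' w ≡ true) × (A v w' ≡ true))
    back-arc k v dv with predecessor (suc k) v dv
    ... | w , dw , wv with predecessor k w dw
    ... | w' , dw' , w'w with qt-path w'w wv w'≢v
      where w'≢v : w' ≢ v
            w'≢v refl = bool-clash (proj₂ dv) (R-suc k w' (AtDistance⇒R k w' dw'))
    ... | inj₁ s = ⊥-elim (bool-clash (proj₂ dv) (R-step k w' v (AtDistance⇒R k w' dw') s))
    ... | inj₂ s = w , w' , (dw , wv) , (dw' , w'w , s)

    toward-u : ∀ k v → AtDistance (suc (suc k)) v → ∀ {y} → A v y ≡ true → A y u ≡ true → A v u ≡ true
    toward-u k v dv vy yu with qt-path vy yu (λ e → AtDistance-≢u (suc k) v dv (sym e))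
    ... | inj₁ s = s
    ... | inj₂ s = ⊥-elim (bool-clash (proj₂ dv) (R-mono 1 (suc k) v (s≤s z≤n) (R-step 0 u v R-u s)))

    distance-2 : ∀ v → AtDistance 2 v → A v u ≡ true
    distance-2 v dv with back-arc 0 v dv
    ... | _ , _ , _ , (refl , _ , vu) = vu

    via-distance-k : ∀ k v → AtDistance (suc (suc k)) v →
      (∀ w' → AtDistance k w' → A w' u ≡ true) → A v u ≡ true
    via-distance-k k v dv ih with back-arc k v dv
    ... | _ , w' , _ , (dw' , _ , vw') = toward-u k v dv vw' (ih w' dw')

    via-distance-k+1 : ∀ k v → AtDistance (suc (suc (suc (suc k)))) v →
      (∀ w → AtDistance (suc (suc (suc k))) w → A w u ≡ true) → A v u ≡ true
    via-distance-k+1 k v dv ih with back-arc (suc (suc k)) v dv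
    ... | w , w' , (dw , _) , (dw' , w'w , vw') =
      toward-u (suc (suc k)) v dv vw' (toward-u k w' dw' w'w (ih w dw))

    dominates-u : ∀ k v → AtDistance (suc (suc k)) v → k ≢ 1 → A v u ≡ true
    dominates-u zero v dv _ = distance-2 v dv
    dominates-u (suc zero) v dv k≢1 = ⊥-elim (k≢1 refl)
    dominates-u (suc (suc zero)) v dv _ =
      via-distance-k 2 v dv (λ w' dw' → dominates-u 0 w' dw' (λ ()))
    dominates-u (suc (suc (suc zero))) v dv _ =
      via-distance-k+1 1 v dv (λ w dw → dominates-u 2 w dw (λ ()))
    dominates-u (suc (suc (suc (suc k)))) v dv _ =
      via-distance-k (4 + k) v dv (λ w' dw' → dominates-u (suc (suc k)) w' dw' (λ ()))

    three-path : ∀ v → Reachable v ≡ true → NonAdjacent u v →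
      ∃₂ λ p q → (A u p ≡ true) × (A p q ≡ true) × (A q v ≡ true)
    three-path v reachable nuv with distance m v reachable
      where m = n D
    ... | zero , e = ⊥-elim (a≢b nuv e)
    ... | suc zero , dv with predecessor 0 v dv
    ...   | w , refl , e = ⊥-elim (bool-clash (no-ab nuv) e)
    three-path v reachable nuv | suc (suc zero) , dv =
      ⊥-elim (bool-clash (no-ba nuv) (dominates-u 0 v dv (λ ())))
    three-path v reachable nuv | suc (suc (suc zero)) , dv with predecessor 2 v dv
    ...   | q , dq , qv with predecessor 1 q dq
    ...     | p , dp , pq with predecessor 0 p dp
    ...       | _ , refl , up = p , q , up , pq , qv
    three-path v reachable nuv | suc (suc (suc (suc k))) , dv =
      ⊥-elim (bool-clash (no-ba nuv) (dominates-u (2 + k) v dv (λ ())))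

-- Suppose a, b are
-- non-adjacent.  Strong connectivity gives a path a → x → y → b, and a lies in
--   S x y = { t | t → x, x ↛ t, y → t, t ↛ y }.
-- Enlarging the pair (x , y) we reach a pair whose S-set is closed under
-- non-adjacency; it then contains the whole non-adjacency component Q of a,
-- but not x.  Every vertex outside Q is adjacent to all of Q in a uniform
-- way, which lets us glue a kernel of D[Q] into a kernel of D.

module QuasiTransitiveCKI (D : Digraph) (loopless : Loopless D) (qt : QuasiTransitive D)
                          (H : Hereditary D) (no-kernel : ¬ HasKernel D) where
  open QuasiTransitiveFacts D loopless qt

  S : Vx → Vx → Vx → Bool
  S x y t = A t x ∧ not (A x t) ∧ A y t ∧ not (A t y)

  record InS (x y t : Vx) : Set where
    constructor ins
    field
      tx : A t x ≡ true
      no-xt : A x t ≡ false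
      yt : A y t ≡ true
      no-ty : A t y ≡ false
  open InS

  InS⇒S : ∀ {x y t} → InS x y t → S x y t ≡ true
  InS⇒S (ins a b c d) rewrite a | b | c | d = refl

  S⇒InS : ∀ {x y t} → S x y t ≡ true → InS x y t
  S⇒InS {x} {y} {t} e with ∧-elim (A t x) e
  ... | a , e₂ with ∧-elim (not (A x t)) e₂
  ... | b , e₃ with ∧-elim (A y t) e₃
  ... | c , d = ins a (not-elim _ b) c (not-elim _ d)

  Adjacent-sym : ∀ {x y} → Adjacent D x y → Adjacent D y x
  Adjacent-sym (inj₁ e) = inj₂ e
  Adjacent-sym (inj₂ e) = inj₁ e

  S-nonadjacent : ∀ {x y s z} → InS x y s → NonAdjacent z x → NonAdjacent z y → Adjacent D s z → ⊥
  S-nonadjacent s∈S nzx nzy sz = no-2-path (NonAdjacent-sym nzy) (yt s∈S) s→z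
    where
    s→z = trans (same-in nzx sz (inj₁ (tx s∈S))) (tx s∈S)

  S-⊆ : ∀ {x y z p q} → NonAdjacent z x → NonAdjacent z y →
    A z p ≡ true → A x p ≡ true → A q z ≡ true → A q y ≡ true → S x y ⊆B S p q
  S-⊆ {x} {y} {z} {p} {q} nzx nzy zp xp qz qy s e = InS⇒S (ins sp ps qs sq)
    where
    s∈S = S⇒InS e
    far : Adjacent D s z → ⊥
    far = S-nonadjacent s∈S nzx nzy
    s≢z : s ≢ z
    s≢z refl = bool-clash (no-ab nzx) (tx s∈S)
    ps : A p s ≡ false
    ps with b-cases (A p s)
    ... | inj₂ r = r
    ... | inj₁ r = ⊥-elim (far (Adjacent-sym (qt-path zp r (λ e → s≢z (sym e)))))
    sp : A s p ≡ true
    sp with qt-path (tx s∈S) xp (λ { refl → bool-clash (no-xt s∈S) xp })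
    ... | inj₁ r = r
    ... | inj₂ r = ⊥-elim (bool-clash ps r)
    sq : A s q ≡ false
    sq with b-cases (A s q)
    ... | inj₂ r = r
    ... | inj₁ r = ⊥-elim (far (qt-path r qz s≢z))
    qs : A q s ≡ true
    qs with qt-path qy (yt s∈S) (λ { refl → bool-clash (no-ty s∈S) qy })
    ... | inj₁ r = r
    ... | inj₂ r = ⊥-elim (bool-clash sq r)

  record Enlargement (x y z : Vx) : Set where
    constructor enlargement
    field
      p q : Vx
      pq : A p q ≡ true
      larger : S x y ⊆B S p q
      z∈S : InS p q z

  -- A vertex z non-adjacent to x and y can be added to S x y by passing to
  -- the pair (p , q) of a path z → p → q → x.
  enlarge : ∀ {x y z} → A x y ≡ true → NonAdjacent z x → NonAdjacent z y → Enlargement x y z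
  enlarge {x} {y} {z} xy nzx nzy with Distance.three-path z x (strongly-connected D H no-kernel z x) nzx
  ... | p , q , zp , pq , qx = enlargement p q pq (S-⊆ nzx nzy zp xp qz qy) (ins zp pz qz zq)
    where
    xp : A x p ≡ true
    xp with qt-path pq qx (λ { refl → bool-clash (no-ab nzx) zp })
    ... | inj₁ s = ⊥-elim (no-2-path nzx zp s)
    ... | inj₂ s = s
    pz : A p z ≡ false
    pz with b-cases (A p z)
    ... | inj₂ s = s
    ... | inj₁ s = ⊥-elim (no-2-path (NonAdjacent-sym nzx) xp s)
    qz : A q z ≡ true
    qz with qt-path zp pq (λ { refl → bool-clash (no-ab nzx) qx })
    ... | inj₁ s = ⊥-elim (no-2-path nzx s qx)
    ... | inj₂ s = s
    zq : A z q ≡ false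
    zq with b-cases (A z q)
    ... | inj₂ s = s
    ... | inj₁ s = ⊥-elim (no-2-path nzx s qx)
    qy : A q y ≡ true
    qy = trans (sym (same-in nzy (inj₁ qz) (qt-path qx xy (λ { refl → bool-clash (no-ba nzy) qz })))) qz

  S-absorbs : ∀ {x y t z} → A x y ≡ true → InS x y t → NonAdjacent t z → Adjacent D z x ⊎ Adjacent D z y → InS x y z
  S-absorbs {x} {y} {t} {z} xy t∈S ntz side = ins zx xz yz zy
    where
    zx⇒ : Adjacent D z x → A z x ≡ true
    zx⇒ azx = trans (sym (same-out ntz (inj₂ (tx t∈S)) (Adjacent-sym azx))) (tx t∈S)
    yz⇒ : Adjacent D z y → A y z ≡ true
    yz⇒ azy = trans (sym (same-in ntz (inj₁ (yt t∈S)) (Adjacent-sym azy))) (yt t∈S)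
    both : Adjacent D z x ⊎ Adjacent D z y → Adjacent D z x × Adjacent D z y
    both (inj₁ azx) = azx , qt-path (zx⇒ azx) xy (λ { refl → bool-clash (no-ba ntz) (yt t∈S) })
    both (inj₂ azy) = Adjacent-sym (qt-path xy (yz⇒ azy) (λ { refl → bool-clash (no-ab ntz) (tx t∈S) })) , azy
    adjacent-both = both side
    zx = zx⇒ (proj₁ adjacent-both)
    xz = trans (sym (same-in ntz (inj₂ (tx t∈S)) (Adjacent-sym (proj₁ adjacent-both)))) (no-xt t∈S)
    yz = yz⇒ (proj₂ adjacent-both)
    zy = trans (sym (same-out ntz (inj₁ (yt t∈S)) (Adjacent-sym (proj₂ adjacent-both)))) (no-ty t∈S)

  -- A vertex z outside S x y but non-adjacent to one of its members is
  -- non-adjacent to x and y, so it can be added by enlarging the pair.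
  escape-enlarges : ∀ {x y t z} → A x y ≡ true → InS x y t → NonAdjacent t z → S x y z ≡ false → Enlargement x y z
  escape-enlarges {x} {y} {t} {z} xy t∈S ntz z∉S
    with b-cases (A z x) | b-cases (A x z) | b-cases (A z y) | b-cases (A y z)
  ... | inj₁ r | _ | _ | _ = ⊥-elim (bool-clash z∉S (InS⇒S (S-absorbs xy t∈S ntz (inj₁ (inj₁ r)))))
  ... | inj₂ _ | inj₁ r | _ | _ = ⊥-elim (bool-clash z∉S (InS⇒S (S-absorbs xy t∈S ntz (inj₁ (inj₂ r)))))
  ... | inj₂ _ | inj₂ _ | inj₁ r | _ = ⊥-elim (bool-clash z∉S (InS⇒S (S-absorbs xy t∈S ntz (inj₂ (inj₁ r)))))
  ... | inj₂ _ | inj₂ _ | inj₂ _ | inj₁ r = ⊥-elim (bool-clash z∉S (InS⇒S (S-absorbs xy t∈S ntz (inj₂ (inj₂ r)))))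
  ... | inj₂ r₁ | inj₂ r₂ | inj₂ r₃ | inj₂ r₄ =
    enlarge xy (nonadjacent r₁ r₂ (λ { refl → bool-clash (no-ab ntz) (tx t∈S) }))
               (nonadjacent r₃ r₄ (λ { refl → bool-clash (no-ba ntz) (yt t∈S) }))

  nonadj : Vx → Vx → Bool
  nonadj t z = not (A t z) ∧ not (A z t) ∧ not (t == z)

  nonadj⇒NonAdjacent : ∀ {t z} → nonadj t z ≡ true → NonAdjacent t z
  nonadj⇒NonAdjacent {t} {z} e with ∧-elim (not (A t z)) e
  ... | a , e₂ with ∧-elim (not (A z t)) e₂
  ... | b , c = nonadjacent (not-elim _ a) (not-elim _ b) (==-false⁻ (not-elim _ c))

  NonAdjacent⇒nonadj : ∀ {t z} → NonAdjacent t z → nonadj t z ≡ true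
  NonAdjacent⇒nonadj (nonadjacent p q r) rewrite p | q | ==-false r = refl

  Closed : Vx → Vx → Set
  Closed x y = ∀ t z → S x y t ≡ true → NonAdjacent t z → S x y z ≡ true

  ClosedPairFor : Vx → Set
  ClosedPairFor a = ∃₂ λ x y → (A x y ≡ true) × (S x y a ≡ true) × Closed x y

  -- Enlarge the pair until S is closed; the size of S strictly increases at
  -- each step, so n D - |S x y| serves as fuel.
  close-up : (fuel : ℕ) → ∀ a x y → A x y ≡ true → S x y a ≡ true →
    n D ∸ count (S x y) ≤ fuel → ClosedPairFor a
  close-up fuel a x y xy a∈S bound with FP.any? (λ t → FP.any? (λ z → escape t z Bool.≟ true))
    where
    escape : Vx → Vx → Bool
    escape t z = S x y t ∧ nonadj t z ∧ not (S x y z)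
  ... | no none = x , y , xy , a∈S , closed
    where
    closed : Closed x y
    closed t z st ntz with b-cases (S x y z)
    ... | inj₁ r = r
    ... | inj₂ r = ⊥-elim (none (t , z , escapes))
      where escapes : (S x y t ∧ nonadj t z ∧ not (S x y z)) ≡ true
            escapes rewrite st | NonAdjacent⇒nonadj ntz | r = refl
  ... | yes (t , z , e) with ∧-elim (S x y t) e
  ...   | st , e₂ with ∧-elim (nonadj t z) e₂
  ...     | ntz , zS with escape-enlarges xy (S⇒InS st) (nonadj⇒NonAdjacent ntz) (not-elim _ zS)
  ...       | enlargement p q pq larger z∈S = recurse fuel bound
    where
    shrinks : n D ∸ count (S p q) < n D ∸ count (S x y)
    shrinks = ∸-monoʳ-< (count-strict (S x y) (S p q) larger z (InS⇒S z∈S) (not-elim _ zS)) (count≤ (S p q))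
    recurse : (f : ℕ) → n D ∸ count (S x y) ≤ f → ClosedPairFor a
    recurse zero b with <-≤-trans shrinks b
    ... | ()
    recurse (suc f) b = close-up f a p q pq (larger a a∈S) (≤-pred (≤-trans shrinks b))

  -- a → x → y → b for non-adjacent a, b puts a into S x y
  start-pair : ∀ {a b} → NonAdjacent a b → ∃₂ λ x y → (A x y ≡ true) × (S x y a ≡ true)
  start-pair {a} {b} nab with Distance.three-path a b (strongly-connected D H no-kernel a b) nab
  ... | x , y , ax , xy , yb = x , y , xy , InS⇒S (ins ax xa ya ay)
    where
    bx : A b x ≡ true
    bx with qt-path xy yb (λ { refl → bool-clash (no-ab nab) ax })
    ... | inj₁ s = ⊥-elim (no-2-path nab ax s)
    ... | inj₂ s = s
    xa : A x a ≡ false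
    xa with b-cases (A x a)
    ... | inj₂ s = s
    ... | inj₁ s = ⊥-elim (no-2-path (NonAdjacent-sym nab) bx s)
    ay : A a y ≡ false
    ay with b-cases (A a y)
    ... | inj₂ s = s
    ... | inj₁ s = ⊥-elim (no-2-path nab s yb)
    ya : A y a ≡ true
    ya with qt-path ax xy (λ { refl → bool-clash (no-ab nab) yb })
    ... | inj₁ s = ⊥-elim (bool-clash ay s)
    ... | inj₂ s = s

  module Component (a : Vx) where
    open Reach nonadj a using (R; R-back; R-step; R-u; Reachable; Reachable-closed; R⇒Reachable; Reachable-u)

    Q : Vx → Bool
    Q = Reachable

    outside-adjacent : ∀ r s → Q r ≡ false → Q s ≡ true → Adjacent D r s
    outside-adjacent r s qr qs with b-cases (A r s) | b-cases (A s r)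
    ... | inj₁ p | _ = inj₁ p
    ... | inj₂ _ | inj₁ p = inj₂ p
    ... | inj₂ p | inj₂ p' = ⊥-elim (bool-clash qr (Reachable-closed s r qs (NonAdjacent⇒nonadj (nonadjacent p' p s≢r))))
      where s≢r : s ≢ r
            s≢r refl = bool-clash qr qs

    uniform : ∀ r → Q r ≡ false → ∀ s → Q s ≡ true → (A r s ≡ A r a) × (A s r ≡ A a r)
    uniform r qr s qs = along (n D) s qs
      where
      along : ∀ i s → R i s ≡ true → (A r s ≡ A r a) × (A s r ≡ A a r)
      along zero s e with ==-true {i = a} {s} e
      ... | refl = refl , refl
      along (suc i) s e with R-back i s e
      ... | inj₁ p = along i s p
      ... | inj₂ (w , rw , ws) =
        trans (sym (same-in nws rw~ rs~)) (proj₁ (along i w rw)) ,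
        trans (sym (same-out nws rw~ rs~)) (proj₂ (along i w rw))
        where
        nws = nonadj⇒NonAdjacent ws
        rw~ = outside-adjacent r w qr (R⇒Reachable i w rw)
        rs~ = outside-adjacent r s qr (R⇒Reachable (suc i) s e)

    Q⊆S : ∀ {x y} → S x y a ≡ true → Closed x y → Q ⊆B S x y
    Q⊆S {x} {y} a∈S closed v = along (n D) v
      where
      along : ∀ i v → R i v ≡ true → S x y v ≡ true
      along zero v e with ==-true {i = a} {v} e
      ... | refl = a∈S
      along (suc i) v e with R-back i v e
      ... | inj₁ r = along i v r
      ... | inj₂ (w , rw , wv) = closed w v (along i w rw) (nonadj⇒NonAdjacent wv)

    -- If a has a non-neighbour, Q is a proper subset: x ∉ S x y ⊇ Q for the
    -- closed pair (x , y) built from it.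
    Q-proper : ∀ {b} → NonAdjacent a b → ∃ λ v → Q v ≡ false
    Q-proper nab with start-pair nab
    ... | x , y , xy , a∈S with close-up (n D) a x y xy a∈S (m∸n≤m (n D) (count (S x y)))
    ...   | x' , y' , _ , a∈S' , closed = x' , x'∉Q
      where
      x'∉Q : Q x' ≡ false
      x'∉Q with b-cases (Q x')
      ... | inj₂ r = r
      ... | inj₁ r = ⊥-elim (bool-clash x'∉S (Q⊆S a∈S' closed x' r))
        where x'∉S : S x' y' x' ≡ false
              x'∉S rewrite loopless x' = refl

    -- Use a
    -- kernel K of the subdigraph induced by (V ∖ Q) ∪ {a}, which misses b:
    -- a ∈ K (else K would absorb all of Q too and be a kernel of D), so no
    -- vertex outside Q is in K, and each is absorbed by a.
    outside-into-a : ∀ {b} → NonAdjacent a b → ∀ r → Q r ≡ false → A r a ≡ true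
    outside-into-a {b} nab r qr = into-a
      where
      P : Vx → Bool
      P v = not (Q v) ∨ (v == a)
      Pb : P b ≡ false
      Pb rewrite R⇒Reachable 1 b (R-step 0 a b R-u (NonAdjacent⇒nonadj nab))
               | ==-false (λ e → a≢b nab (sym e)) = refl
      open KernelOf (H P (b , Pb)) renaming (independent to K-independent; absorbent to K-absorbent)
      outside : ∀ k → P k ≡ true → k ≢ a → Q k ≡ false
      outside k e k≢a with ∨-elim (not (Q k)) e
      ... | inj₁ p = not-elim _ p
      ... | inj₂ p = ⊥-elim (k≢a (==-true p))
      a∈K : K a ≡ true
      a∈K with b-cases (K a)
      ... | inj₁ p = p
      ... | inj₂ p with K-absorbent a (∨-introʳ (not (Q a)) (==-refl a)) p
      ...   | k , kk , ak = ⊥-elim (no-kernel (kernel D K K-independent absorbent))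
        where
        qk = outside k (K⊆P k kk) (λ e → arc-≢ ak (sym e))
        absorbent : ∀ w → K w ≡ false → ∃ λ z → (K z ≡ true) × (A w z ≡ true)
        absorbent w kw with b-cases (P w)
        ... | inj₁ pw = K-absorbent w pw kw
        ... | inj₂ pw = k , kk , trans (proj₂ (uniform k qk w qw)) ak
          where qw = not-false (Q w) (proj₁ (∨-false (not (Q w)) pw))
      not-in-K : ∀ k → K k ≡ true → Q k ≡ false → ⊥
      not-in-K k kk qk with outside-adjacent k a qk Reachable-u
      ... | inj₁ e = bool-clash (K-independent k a kk a∈K) e
      ... | inj₂ e = bool-clash (K-independent a k a∈K kk) e
      into-a : A r a ≡ true
      into-a with b-cases (K r)
      ... | inj₁ kr = ⊥-elim (not-in-K r kr qr)
      ... | inj₂ kr with K-absorbent r (∨-introˡ (not-intro qr)) kr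
      ...   | k , kk , rk with k F.≟ a
      ...     | yes refl = rk
      ...     | no k≢a = ⊥-elim (not-in-K k kk (outside k (K⊆P k kk) k≢a))

    component-kernel : (∃ λ v → Q v ≡ false) → (∀ r → Q r ≡ false → A r a ≡ true) → HasKernel D
    component-kernel (v , qv) into-a = kernel D K K-independent absorbent
      where
      open KernelOf (H Q (v , qv)) renaming (K⊆P to K⊆Q; independent to K-independent; absorbent to K-absorbent)
      some-k : ∃ λ k → K k ≡ true
      some-k with b-cases (K a)
      ... | inj₁ p = a , p
      ... | inj₂ p with K-absorbent a Reachable-u p
      ...   | k , kk , _ = k , kk
      k = proj₁ some-k
      absorbent : ∀ w → K w ≡ false → ∃ λ z → (K z ≡ true) × (A w z ≡ true)
      absorbent w kw with b-cases (Q w)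
      ... | inj₁ qw = K-absorbent w qw kw
      ... | inj₂ qw = k , proj₂ some-k ,
                      trans (proj₁ (uniform w qw k (K⊆Q k (proj₂ some-k)))) (into-a w qw)

  semicomplete : Semicomplete D
  semicomplete = semicomplete-if D λ a b a≢b p q →
    let open Component a
        nab = nonadjacent p q a≢b
    in no-kernel (component-kernel (Q-proper nab) (outside-into-a nab))

-- The only missing arcs u → x of E are the
-- loops and the arcs σ x → x, which form a directed Hamiltonian cycle: σ is
-- a cyclic permutation (no proper nonempty σ-invariant set) of order at
-- least three.

record CycleComplement (E : Digraph) : Set where
  field
    σ : Fin (n E) → Fin (n E)
    non-arc⇒ : ∀ u x → arc E u x ≡ false → (u ≡ x) ⊎ (u ≡ σ x)
    non-arc⇐ : ∀ u x → (u ≡ x) ⊎ (u ≡ σ x) → arc E u x ≡ false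
    σ-injective : ∀ x y → σ x ≡ σ y → x ≡ y
    σ-no-fixpoint : ∀ x → σ x ≢ x
    σ²-no-fixpoint : ∀ x → σ (σ x) ≢ x
    σ-leaves : ∀ (P : Fin (n E) → Bool) p q → P p ≡ true → P q ≡ false →
      ∃ λ x → (P x ≡ true) × (P (σ x) ≡ false)
    base : Fin (n E)

-- Each K v is independent,
-- hence a single vertex f v; its only non-in-neighbour is v.  So f is
-- injective, hence a permutation, and σ = f⁻¹ sends x to the unique vertex
-- other than x not dominating x.

module SemicompleteCKI (D : Digraph) (loopless : Loopless D) (semicomplete : Semicomplete D)
                       (H : Hereditary D) (no-kernel : ¬ HasKernel D) where
  open DeleteVertex D H no-kernel

  private
    Vx = Fin (n D)
    A = arc D

  independent-≡ : ∀ x y → A x y ≡ false → A y x ≡ false → x ≡ y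
  independent-≡ x y p q with x F.≟ y
  ... | yes e = e
  ... | no x≢y with semicomplete x y x≢y
  ...   | inj₁ r = ⊥-elim (bool-clash p r)
  ...   | inj₂ r = ⊥-elim (bool-clash q r)

  -- D has a second vertex: a single loopless vertex would be a kernel
  another : ∀ v → ∃ λ w → w ≢ v
  another v with FP.any? (λ w → ¬? (w F.≟ v))
  ... | yes found = found
  ... | no none = ⊥-elim (no-kernel (kernel D (_== v) independent absorbent))
    where
    all-v : ∀ w → w ≡ v
    all-v w with w F.≟ v
    ... | yes e = e
    ... | no w≢v = ⊥-elim (none (w , w≢v))
    independent : ∀ x y → (x == v) ≡ true → (y == v) ≡ true → A x y ≡ false
    independent x y _ _ rewrite all-v x | all-v y = loopless v
    absorbent : ∀ w → (w == v) ≡ false → ∃ λ z → ((z == v) ≡ true) × (A w z ≡ true)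
    absorbent w w≠v = ⊥-elim (==-false⁻ w≠v (all-v w))

  f : Vx → Vx
  f v = proj₁ (K-nonempty v (proj₁ (another v)) (proj₂ (another v)))

  f∈K : ∀ v → K v (f v) ≡ true
  f∈K v = proj₂ (K-nonempty v (proj₁ (another v)) (proj₂ (another v)))

  K-singleton : ∀ v k → K v k ≡ true → k ≡ f v
  K-singleton v k kk = independent-≡ k (f v) (K-independent v k (f v) kk (f∈K v)) (K-independent v (f v) k (f∈K v) kk)

  non-dominator : ∀ v u → u ≢ f v → A u (f v) ≡ false → u ≡ v
  non-dominator v u u≢fv no-arc with u F.≟ v
  ... | yes e = e
  ... | no u≢v with b-cases (K v u)
  ...   | inj₁ ku = ⊥-elim (u≢fv (K-singleton v u ku))
  ...   | inj₂ ku with K-absorbent v u u≢v ku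
  ...     | z , kz , uz = ⊥-elim (bool-clash no-arc (subst (λ t → A u t ≡ true) (K-singleton v z kz) uz))

  f-injective : ∀ v w → f v ≡ f w → v ≡ w
  f-injective v w e = non-dominator w v v≢fw (subst (λ t → A v t ≡ false) e (K-no-arc-from v (f v) (f∈K v)))
    where v≢fw : v ≢ f w
          v≢fw e₂ = K-≢ v (f v) (f∈K v) (trans e (sym e₂))

  σ : Vx → Vx
  σ x = proj₁ (inj⇒surj f f-injective x)

  fσ : ∀ x → f (σ x) ≡ x
  fσ x = proj₂ (inj⇒surj f f-injective x)

  σ-no-arc : ∀ x → A (σ x) x ≡ false
  σ-no-arc x = subst (λ t → A (σ x) t ≡ false) (fσ x) (K-no-arc-from (σ x) (f (σ x)) (f∈K (σ x)))

  σ-no-fixpoint : ∀ x → σ x ≢ x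
  σ-no-fixpoint x e = K-≢ (σ x) (f (σ x)) (f∈K (σ x)) (trans (fσ x) (sym e))

  σ-injective : ∀ x y → σ x ≡ σ y → x ≡ y
  σ-injective x y e = trans (sym (fσ x)) (trans (cong f e) (fσ y))

  σ²-no-fixpoint : ∀ x → σ (σ x) ≢ x
  σ²-no-fixpoint x e with semicomplete x (σ x) (λ e₂ → σ-no-fixpoint x (sym e₂))
  ... | inj₁ r = bool-clash (subst (λ t → A t (σ x) ≡ false) e (σ-no-arc (σ x))) r
  ... | inj₂ r = bool-clash (σ-no-arc x) r

  non-arc⇒ : ∀ u x → A u x ≡ false → (u ≡ x) ⊎ (u ≡ σ x)
  non-arc⇒ u x no-arc with u F.≟ x
  ... | yes e = inj₁ e
  ... | no u≢x = inj₂ (non-dominator (σ x) u (λ e → u≢x (trans e (fσ x)))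
                         (subst (λ t → A u t ≡ false) (sym (fσ x)) no-arc))

  non-arc⇐ : ∀ u x → (u ≡ x) ⊎ (u ≡ σ x) → A u x ≡ false
  non-arc⇐ u .u (inj₁ refl) = loopless u
  non-arc⇐ .(σ x) x (inj₂ refl) = σ-no-arc x

  -- A kernel of a proper induced subdigraph D[P] is a single vertex x; it
  -- absorbs σ x only if σ x ∉ P.
  σ-leaves : ∀ (P : Vx → Bool) p q → P p ≡ true → P q ≡ false → ∃ λ x → (P x ≡ true) × (P (σ x) ≡ false)
  σ-leaves P p q pp pq with H P (q , pq)
  ... | K , K⊆P , K-independent , K-absorbent = x , K⊆P x kx , σx∉P
    where
    some-x : ∃ λ x → K x ≡ true
    some-x with b-cases (K p)
    ... | inj₁ r = p , r
    ... | inj₂ r with K-absorbent p pp r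
    ...   | z , kz , _ = z , kz
    x = proj₁ some-x
    kx = proj₂ some-x
    only-x : ∀ z → K z ≡ true → z ≡ x
    only-x z kz = independent-≡ z x (K-independent z x kz kx) (K-independent x z kx kz)
    σx∉P : P (σ x) ≡ false
    σx∉P with b-cases (P (σ x))
    ... | inj₂ r = r
    ... | inj₁ r with b-cases (K (σ x))
    ...   | inj₁ k = ⊥-elim (σ-no-fixpoint x (only-x (σ x) k))
    ...   | inj₂ k with K-absorbent (σ x) r k
    ...     | z , kz , σx→z = ⊥-elim (bool-clash (σ-no-arc x) (subst (λ t → A (σ x) t ≡ true) (only-x z kz) σx→z))

  cycle-complement : CycleComplement D
  cycle-complement = record
    { σ = σ
    ; non-arc⇒ = non-arc⇒
    ; non-arc⇐ = non-arc⇐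
    ; σ-injective = σ-injective
    ; σ-no-fixpoint = σ-no-fixpoint
    ; σ²-no-fixpoint = σ²-no-fixpoint
    ; σ-leaves = σ-leaves
    ; base = some-vertex D no-kernel
    }

module _ {E : Digraph} (c : CycleComplement E) where
  open CycleComplement c

  private
    A = arc E

  -- A cycle complement has no kernel: a kernel vertex x would have to
  -- absorb σ x, which does not dominate x.
  cycle-complement-no-kernel : ¬ HasKernel E
  cycle-complement-no-kernel (K , _ , K-independent , K-absorbent) = σx-unabsorbed
    where
    some-x : ∃ λ x → K x ≡ true
    some-x with b-cases (K base)
    ... | inj₁ r = base , r
    ... | inj₂ r with K-absorbent base refl r
    ...   | z , kz , _ = z , kz
    x = proj₁ some-x
    kx = proj₂ some-x
    σx-unabsorbed : ⊥
    σx-unabsorbed with b-cases (K (σ x))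
    ... | inj₁ k with non-arc⇒ x (σ x) (K-independent x (σ x) kx k)
    ...   | inj₁ e = σ-no-fixpoint x (sym e)
    ...   | inj₂ e = σ²-no-fixpoint x (sym e)
    σx-unabsorbed | inj₂ k with K-absorbent (σ x) refl k
    ...   | y , ky , σx→y with y F.≟ x
    ...     | yes refl = bool-clash (non-arc⇐ (σ y) y (inj₂ refl)) σx→y
    ...     | no y≢x with non-arc⇒ y x (K-independent y x ky kx)
    ...       | inj₁ e = y≢x e
    ...       | inj₂ refl = bool-clash (non-arc⇐ (σ x) (σ x) (inj₁ refl)) σx→y

  -- In a proper induced subdigraph D[P], a vertex x ∈ P with σ x ∉ P is
  -- dominated by all other vertices of P, so {x} is a kernel.
  cycle-complement-hereditary : Hereditary E
  cycle-complement-hereditary P (q , pq) with FP.any? (λ v → P v Bool.≟ true)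
  ... | no empty = (λ _ → false) , (λ _ ()) , (λ _ _ ()) , λ u pu _ → ⊥-elim (empty (u , pu))
  ... | yes (p , pp) with σ-leaves P p q pp pq
  ...   | x , px , pσx = (_== x) , K⊆P , K-independent , K-absorbent
    where
    K⊆P : ∀ w → (w == x) ≡ true → P w ≡ true
    K⊆P w e with ==-true {i = w} {x} e
    ... | refl = px
    K-independent : ∀ u w → (u == x) ≡ true → (w == x) ≡ true → A u w ≡ false
    K-independent u w e₁ e₂ with ==-true {i = u} {x} e₁ | ==-true {i = w} {x} e₂
    ... | refl | refl = non-arc⇐ u u (inj₁ refl)
    K-absorbent : ∀ u → P u ≡ true → (u == x) ≡ false → ∃ λ z → ((z == x) ≡ true) × (A u z ≡ true)
    K-absorbent u pu u≠x = x , ==-refl x , u→x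
      where
      u→x : A u x ≡ true
      u→x with b-cases (A u x)
      ... | inj₁ t = t
      ... | inj₂ f with non-arc⇒ u x f
      ...   | inj₁ e = ⊥-elim (==-false⁻ u≠x e)
      ...   | inj₂ refl = ⊥-elim (bool-clash pσx pu)

  cycle-complement-CKI : CKI E
  cycle-complement-CKI = cycle-complement-no-kernel , cycle-complement-hereditary

transport : ∀ {D E} → D ≅ E → CycleComplement E → CycleComplement D
transport {D} {E} iso c = record
  { σ = σD
  ; non-arc⇒ = non-arc⇒D
  ; non-arc⇐ = non-arc⇐D
  ; σ-injective = λ x y e → to-injective (σ-injective (to x) (to y)
                              (trans (sym (to-from _)) (trans (cong to e) (to-from _))))
  ; σ-no-fixpoint = λ x e → σ-no-fixpoint (to x) (trans (sym (to-from _)) (cong to e))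
  ; σ²-no-fixpoint = λ x e → σ²-no-fixpoint (to x) (trans (cong σ (sym (to-from _))) (trans (sym (to-from _)) (cong to e)))
  ; σ-leaves = leaves
  ; base = from base
  }
  where
  open CycleComplement c
  to = Inverse.to (_≅_.bij iso)
  from = Inverse.from (_≅_.bij iso)
  to-from : ∀ y → to (from y) ≡ y
  to-from y = Inverse.inverseˡ (_≅_.bij iso) refl
  from-to : ∀ x → from (to x) ≡ x
  from-to x = Inverse.inverseʳ (_≅_.bij iso) refl
  to-injective : ∀ {x y} → to x ≡ to y → x ≡ y
  to-injective {x} {y} e = trans (sym (from-to x)) (trans (cong from e) (from-to y))
  σD : Fin (n D) → Fin (n D)
  σD x = from (σ (to x))
  pres = _≅_.pres iso
  non-arc⇒D : ∀ u x → arc D u x ≡ false → (u ≡ x) ⊎ (u ≡ σD x)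
  non-arc⇒D u x e with non-arc⇒ (to u) (to x) (trans (sym (pres u x)) e)
  ... | inj₁ e₂ = inj₁ (to-injective e₂)
  ... | inj₂ e₂ = inj₂ (trans (sym (from-to u)) (cong from e₂))
  non-arc⇐D : ∀ u x → (u ≡ x) ⊎ (u ≡ σD x) → arc D u x ≡ false
  non-arc⇐D u .u (inj₁ refl) = trans (pres u u) (non-arc⇐ (to u) (to u) (inj₁ refl))
  non-arc⇐D .(σD x) x (inj₂ refl) = trans (pres (σD x) x) (non-arc⇐ (to (σD x)) (to x) (inj₂ (to-from _)))
  leaves : ∀ (P : Fin (n D) → Bool) p q → P p ≡ true → P q ≡ false → ∃ λ x → (P x ≡ true) × (P (σD x) ≡ false)
  leaves P p q pp pq with σ-leaves (λ y → P (from y)) (to p) (to q)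
                            (subst (λ t → P t ≡ true) (sym (from-to p)) pp)
                            (subst (λ t → P t ≡ false) (sym (from-to q)) pq)
  ... | y , py , pσy = from y , py , subst (λ t → P (from (σ t)) ≡ false) (sym (to-from y)) pσy

sucF : ∀ {N} → Fin N → Fin N
sucF {suc N} k with suc (toℕ k) <? suc N
... | yes k+1<N = F.fromℕ< k+1<N
... | no _ = F.zero

Successor : ℕ → ℕ → ℕ → Set
Successor N b a = ((suc b < N) × (a ≡ suc b)) ⊎ ((suc b ≡ N) × (a ≡ 0))

toℕ-sucF : ∀ {N} (k : Fin N) → Successor N (toℕ k) (toℕ (sucF k))
toℕ-sucF {suc N} k with suc (toℕ k) <? suc N
... | yes k+1<N = inj₁ (k+1<N , FP.toℕ-fromℕ< k+1<N)
... | no k+1≮N = inj₂ (≤-antisym (toℕ<n k) (≮⇒≥ k+1≮N) , refl)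

Successor-unique : ∀ {N b a a'} → Successor N b a → Successor N b a' → a ≡ a'
Successor-unique (inj₁ (_ , e)) (inj₁ (_ , e')) = trans e (sym e')
Successor-unique (inj₂ (_ , e)) (inj₂ (_ , e')) = trans e (sym e')
Successor-unique (inj₁ (l , _)) (inj₂ (e , _)) = ⊥-elim (<-irrefl e l)
Successor-unique (inj₂ (e , _)) (inj₁ (l , _)) = ⊥-elim (<-irrefl e l)

Successor⇒sucF : ∀ {N} (i j : Fin N) → Successor N (toℕ j) (toℕ i) → i ≡ sucF j
Successor⇒sucF i j s = toℕ-injective (Successor-unique s (toℕ-sucF j))

sucF-injective : ∀ {N} (i j : Fin N) → sucF i ≡ sucF j → i ≡ j
sucF-injective i j e with toℕ-sucF i | subst (λ t → Successor _ (toℕ j) (toℕ t)) (sym e) (toℕ-sucF j)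
... | inj₁ (_ , a) | inj₁ (_ , b) = toℕ-injective (suc-injective (trans (sym a) b))
... | inj₂ (a , _) | inj₂ (b , _) = toℕ-injective (suc-injective (trans a (sym b)))
... | inj₁ (_ , a) | inj₂ (_ , b) with trans (sym a) b
...   | ()
sucF-injective i j e | inj₂ (_ , a) | inj₁ (_ , b) with trans (sym b) a
...   | ()

cast-sucF : ∀ {N M} (e : N ≡ M) (i : Fin N) → F.cast e (sucF i) ≡ sucF (F.cast e i)
cast-sucF refl i = trans (FP.cast-is-id refl (sucF i)) (cong sucF (sym (FP.cast-is-id refl i)))

iterate : ∀ {X : Set} → (X → X) → ℕ → X → X
iterate f zero x = x
iterate f (suc k) x = f (iterate f k x)

iterate-+ : ∀ {X : Set} (f : X → X) a b x → iterate f (a + b) x ≡ iterate f a (iterate f b x)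
iterate-+ f zero b x = refl
iterate-+ f (suc a) b x = cong f (iterate-+ f a b x)

module Orbit {E : Digraph} (c : CycleComplement E) where
  open CycleComplement c

  private
    N = n E

  walk : ℕ → Fin N
  walk k = iterate σ k base

  iterate-injective : ∀ a x y → iterate σ a x ≡ iterate σ a y → x ≡ y
  iterate-injective zero x y e = e
  iterate-injective (suc a) x y e = iterate-injective a x y (σ-injective _ _ e)

  -- The walk does not return to base before N steps: otherwise its first p
  -- vertices form a σ-invariant set, which must be all of E, so N ≤ p.
  no-early-return : ∀ p → 0 < p → p < N → walk p ≢ base
  no-early-return p@(suc p-1) _ p<N returns = <-irrefl refl (<-≤-trans p<N (injective⇒≤ {f = index} index-injective))
    where
    visited : Fin N → Bool
    visited v = anyF {p} (λ i → walk (toℕ i) == v)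
    visited-closed : ∀ v → visited v ≡ true → visited (σ v) ≡ true
    visited-closed v e with anyF-elim {p} (λ i → walk (toℕ i) == v) e
    ... | i , walk-i with ==-true {i = walk (toℕ i)} {v} walk-i | suc (toℕ i) <? p
    ...   | refl | yes i+1<p = anyF-intro {p} (λ i → walk (toℕ i) == σ v) (F.fromℕ< i+1<p)
                                 (subst (λ t → (walk t == σ v) ≡ true) (sym (FP.toℕ-fromℕ< i+1<p)) (==-refl (σ v)))
    ...   | refl | no i+1≮p = anyF-intro {p} (λ i → walk (toℕ i) == σ v) F.zero (subst (λ t → (t == σ v) ≡ true) σv≡base (==-refl (σ v)))
      where σv≡base : σ v ≡ base
            σv≡base = trans (cong walk (≤-antisym (toℕ<n i) (≮⇒≥ i+1≮p))) returns
    all-visited : ∀ v → visited v ≡ true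
    all-visited v with b-cases (visited v)
    ... | inj₁ r = r
    ... | inj₂ r with σ-leaves visited base v (anyF-intro {p} (λ i → walk (toℕ i) == base) F.zero (==-refl base)) r
    ...   | x , vx , vσx = ⊥-elim (bool-clash vσx (visited-closed x vx))
    index : Fin N → Fin p
    index v = proj₁ (anyF-elim {p} (λ i → walk (toℕ i) == v) (all-visited v))
    walk-index : ∀ v → walk (toℕ (index v)) ≡ v
    walk-index v = ==-true (proj₂ (anyF-elim {p} (λ i → walk (toℕ i) == v) (all-visited v)))
    index-injective : ∀ {x y} → index x ≡ index y → x ≡ y
    index-injective {x} {y} e = trans (sym (walk-index x)) (trans (cong (λ t → walk (toℕ t)) e) (walk-index y))

  returns : ∀ a b → a < b → walk a ≡ walk b → base ≡ walk (b ∸ a)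
  returns a b a<b e = iterate-injective a base (walk (b ∸ a))
    (trans e (trans (cong walk (sym (m+[n∸m]≡n (<⇒≤ a<b)))) (iterate-+ σ a (b ∸ a) base)))

  walk-distinct : ∀ a b → a < b → b < N → walk a ≢ walk b
  walk-distinct a b a<b b<N e =
    no-early-return (b ∸ a) (m<n⇒0<n∸m a<b) (≤-<-trans (m∸n≤m b a) b<N) (sym (returns a b a<b e))

  φ : Fin N → Fin N
  φ k = walk (toℕ k)

  φ-injective : ∀ i j → φ i ≡ φ j → i ≡ j
  φ-injective i j e with <-cmp (toℕ i) (toℕ j)
  ... | tri< lt _ _ = ⊥-elim (walk-distinct (toℕ i) (toℕ j) lt (toℕ<n j) e)
  ... | tri≈ _ eq _ = toℕ-injective eq
  ... | tri> _ _ gt = ⊥-elim (walk-distinct (toℕ j) (toℕ i) gt (toℕ<n i) (sym e))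

  ψ : Fin N → Fin N
  ψ v = proj₁ (inj⇒surj φ φ-injective v)

  φψ : ∀ v → φ (ψ v) ≡ v
  φψ v = proj₂ (inj⇒surj φ φ-injective v)

  ψφ : ∀ i → ψ (φ i) ≡ i
  ψφ i = φ-injective _ _ (φψ (φ i))

  walk-N : walk N ≡ base
  walk-N with ψ (walk N) | φψ (walk N)
  ... | k | e with toℕ k ≟ℕ 0
  ...   | yes k≡0 = trans (sym e) (cong walk k≡0)
  ...   | no k≢0 = ⊥-elim (no-early-return (N ∸ toℕ k) (m<n⇒0<n∸m (toℕ<n k))
                        (∸-monoʳ-< (n≢0⇒n>0 k≢0) (<⇒≤ (toℕ<n k))) (sym (returns (toℕ k) N (toℕ<n k) e)))

  σ-φ : ∀ k → σ (φ k) ≡ φ (sucF k)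
  σ-φ k with toℕ-sucF k
  ... | inj₁ (_ , e) = cong walk (sym e)
  ... | inj₂ (e₁ , e₂) = trans (cong walk e₁) (trans walk-N (cong walk (sym e₂)))

  ψ-σ : ∀ v → ψ (σ v) ≡ sucF (ψ v)
  ψ-σ v = φ-injective _ _ (trans (φψ (σ v)) (trans (cong σ (sym (φψ v))) (σ-φ (ψ v))))

  -- base, σ base and σ² base are distinct, so E has at least three vertices
  order≥3 : 3 ≤ N
  order≥3 = injective⇒≤ {f = λ (i : Fin 3) → walk (toℕ i)} walk-injective
    where
    no-short-return : ∀ d → 0 < d → d < 3 → walk d ≢ base
    no-short-return (suc zero) _ _ = σ-no-fixpoint base
    no-short-return (suc (suc zero)) _ _ = σ²-no-fixpoint base
    no-short-return (suc (suc (suc _))) _ (s≤s (s≤s (s≤s ())))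
    walk-injective : ∀ {i j : Fin 3} → walk (toℕ i) ≡ walk (toℕ j) → i ≡ j
    walk-injective {i} {j} e with <-cmp (toℕ i) (toℕ j)
    ... | tri< lt _ _ = ⊥-elim (no-short-return (toℕ j ∸ toℕ i) (m<n⇒0<n∸m lt)
                          (≤-<-trans (m∸n≤m (toℕ j) (toℕ i)) (toℕ<n j)) (sym (returns _ _ lt e)))
    ... | tri≈ _ eq _ = toℕ-injective eq
    ... | tri> _ _ gt = ⊥-elim (no-short-return (toℕ i ∸ toℕ j) (m<n⇒0<n∸m gt)
                          (≤-<-trans (m∸n≤m (toℕ i) (toℕ j)) (toℕ<n i)) (sym (returns _ _ gt (sym e))))

-- A bijection between cycle complements intertwining their cycles is an
-- isomorphism: it maps the missing arcs σ x → x onto missing arcs.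
intertwining-iso : ∀ {D E} (cD : CycleComplement D) (cE : CycleComplement E) (β : Fin (n D) ↔ Fin (n E)) →
  (∀ x → Inverse.to β (CycleComplement.σ cD x) ≡ CycleComplement.σ cE (Inverse.to β x)) → D ≅ E
intertwining-iso {D} {E} cD cE β β-σ = record { bij = β ; pres = pres }
  where
  open CycleComplement cD using () renaming (σ to σD; non-arc⇒ to non-arc⇒D; non-arc⇐ to non-arc⇐D)
  open CycleComplement cE using () renaming (σ to σE; non-arc⇒ to non-arc⇒E; non-arc⇐ to non-arc⇐E)
  to = Inverse.to β
  to-injective : ∀ {x y} → to x ≡ to y → x ≡ y
  to-injective {x} {y} e = trans (sym (Inverse.inverseʳ β refl)) (trans (cong (Inverse.from β) e) (Inverse.inverseʳ β refl))
  pres : ∀ u v → arc D u v ≡ arc E (to u) (to v)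
  pres u v with b-cases (arc E (to u) (to v)) | b-cases (arc D u v)
  ... | inj₁ t | inj₁ t' = trans t' (sym t)
  ... | inj₂ f | _ = trans (non-arc⇐D u v non-arc) (sym f)
    where
    non-arc : (u ≡ v) ⊎ (u ≡ σD v)
    non-arc with non-arc⇒E (to u) (to v) f
    ... | inj₁ e = inj₁ (to-injective e)
    ... | inj₂ e = inj₂ (to-injective (trans e (sym (β-σ v))))
  ... | inj₁ t | inj₂ f = ⊥-elim (bool-clash (non-arc⇐E (to u) (to v) non-arc) t)
    where
    non-arc : (to u ≡ to v) ⊎ (to u ≡ σE (to v))
    non-arc with non-arc⇒D u v f
    ... | inj₁ e = inj₁ (cong to e)
    ... | inj₂ e = inj₂ (trans (cong to e) (β-σ v))

-- Two cycle complements of the same order are isomorphic: matching their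
-- enumerations along the cycles intertwines the two permutations.
cycle-complements-isomorphic : ∀ {D E} → CycleComplement D → CycleComplement E → n D ≡ n E → D ≅ E
cycle-complements-isomorphic {D} {E} cD cE e = intertwining-iso cD cE (mk↔ₛ′ to from to-from from-to) to-σ
  where
  open ≡-Reasoning
  module OD = Orbit cD
  module OE = Orbit cE
  open CycleComplement cD using () renaming (σ to σD)
  open CycleComplement cE using () renaming (σ to σE)
  to : Fin (n D) → Fin (n E)
  to x = OE.φ (F.cast e (OD.ψ x))
  from : Fin (n E) → Fin (n D)
  from y = OD.φ (F.cast (sym e) (OE.ψ y))
  to-from : ∀ y → to (from y) ≡ y
  to-from y = begin
    OE.φ (F.cast e (OD.ψ (OD.φ (F.cast (sym e) (OE.ψ y))))) ≡⟨ cong (λ i → OE.φ (F.cast e i)) (OD.ψφ _) ⟩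
    OE.φ (F.cast e (F.cast (sym e) (OE.ψ y)))              ≡⟨ cong OE.φ (FP.cast-involutive e (sym e) _) ⟩
    OE.φ (OE.ψ y)                                          ≡⟨ OE.φψ y ⟩
    y                                                      ∎
  from-to : ∀ x → from (to x) ≡ x
  from-to x = begin
    OD.φ (F.cast (sym e) (OE.ψ (OE.φ (F.cast e (OD.ψ x))))) ≡⟨ cong (λ i → OD.φ (F.cast (sym e) i)) (OE.ψφ _) ⟩
    OD.φ (F.cast (sym e) (F.cast e (OD.ψ x)))               ≡⟨ cong OD.φ (FP.cast-involutive (sym e) e _) ⟩
    OD.φ (OD.ψ x)                                           ≡⟨ OD.φψ x ⟩
    x                                                       ∎
  to-σ : ∀ x → to (σD x) ≡ σE (to x)
  to-σ x = begin
    OE.φ (F.cast e (OD.ψ (σD x)))   ≡⟨ cong (λ i → OE.φ (F.cast e i)) (OD.ψ-σ x) ⟩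
    OE.φ (F.cast e (sucF (OD.ψ x))) ≡⟨ cong OE.φ (cast-sucF e (OD.ψ x)) ⟩
    OE.φ (sucF (F.cast e (OD.ψ x))) ≡⟨ sym (OE.σ-φ _) ⟩
    σE (to x)                       ∎

Position : ∀ k → Fin (suc k) → Fin (suc k) → Set
Position k i j = (toℕ i ≤ toℕ j) ⊎ (∃ λ c → (toℕ j + suc c ≤ k) × (toℕ i ≡ toℕ j + suc c))

position : ∀ k (i j : Fin (suc k)) → Position k i j
position k i j with toℕ i ≤? toℕ j
... | yes i≤j = inj₁ i≤j
... | no i≰j = inj₂ (c , ≤-pred (subst (_< suc k) i≡j+c+1 (toℕ<n i)) , i≡j+c+1)
  where
  c = toℕ i ∸ suc (toℕ j)
  i≡j+c+1 : toℕ i ≡ toℕ j + suc c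
  i≡j+c+1 = trans (sym (m+[n∸m]≡n (≰⇒> i≰j))) (sym (+-suc (toℕ j) c))

diffMod-≤ : ∀ k (i j : Fin (suc k)) → toℕ i ≤ toℕ j → diffMod (suc k) i j ≡ toℕ j ∸ toℕ i
diffMod-≤ k i j i≤j = begin
  ((toℕ j + suc k) ∸ toℕ i) % suc k  ≡⟨ cong (_% suc k) (+-∸-comm (suc k) i≤j) ⟩
  ((toℕ j ∸ toℕ i) + suc k) % suc k  ≡⟨ [m+n]%n≡m%n (toℕ j ∸ toℕ i) (suc k) ⟩
  (toℕ j ∸ toℕ i) % suc k            ≡⟨ m<n⇒m%n≡m (≤-<-trans (m∸n≤m (toℕ j) (toℕ i)) (toℕ<n j)) ⟩
  toℕ j ∸ toℕ i                      ∎
  where open ≡-Reasoning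

diffMod-> : ∀ k (i j : Fin (suc k)) c → toℕ i ≡ toℕ j + suc c → diffMod (suc k) i j ≡ k ∸ c
diffMod-> k i j c i≡j+c+1 = begin
  ((toℕ j + suc k) ∸ toℕ i) % suc k              ≡⟨ cong (λ t → ((toℕ j + suc k) ∸ t) % suc k) i≡j+c+1 ⟩
  ((toℕ j + suc k) ∸ (toℕ j + suc c)) % suc k    ≡⟨ cong (_% suc k) ([m+n]∸[m+o]≡n∸o (toℕ j) (suc k) (suc c)) ⟩
  (k ∸ c) % suc k                                ≡⟨ m<n⇒m%n≡m (s≤s (m∸n≤m k c)) ⟩
  k ∸ c                                          ∎
  where open ≡-Reasoning

-- If j + (c + 1) ≤ k then j < k - c: the two closed forms never meet.
below-shift : ∀ {j c k} → j + suc c ≤ k → j < k ∸ c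
below-shift {j} {c} {k} le = subst (_≤ k ∸ c) (m+n∸n≡m (suc j) c) (∸-monoˡ-≤ c (subst (_≤ k) (+-suc j c) le))

diffMod-injective : ∀ k (i i' j : Fin (suc k)) → diffMod (suc k) i j ≡ diffMod (suc k) i' j → i ≡ i'
diffMod-injective k i i' j e with position k i j | position k i' j
... | inj₁ i≤j | inj₁ i'≤j =
  toℕ-injective (∸-cancelˡ-≡ i≤j i'≤j (trans (sym (diffMod-≤ k i j i≤j)) (trans e (diffMod-≤ k i' j i'≤j))))
... | inj₂ (c , le , ei) | inj₂ (c' , le' , ei') =
  toℕ-injective (trans ei (trans (cong (λ t → toℕ j + suc t) c≡c') (sym ei')))
  where
  bound : ∀ {x} → toℕ j + suc x ≤ k → x ≤ k
  bound le = ≤-trans (n≤1+n _) (≤-trans (m≤n+m (suc _) (toℕ j)) le)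
  c≡c' = ∸-cancelˡ-≡ (bound le) (bound le') (trans (sym (diffMod-> k i j c ei)) (trans e (diffMod-> k i' j c' ei')))
... | inj₁ i≤j | inj₂ (c' , le' , ei') = ⊥-elim (<-irrefl gap (≤-<-trans (m∸n≤m (toℕ j) (toℕ i)) (below-shift le')))
  where gap = trans (sym (diffMod-≤ k i j i≤j)) (trans e (diffMod-> k i' j c' ei'))
... | inj₂ (c , le , ei) | inj₁ i'≤j = ⊥-elim (<-irrefl (sym gap) (≤-<-trans (m∸n≤m (toℕ j) (toℕ i')) (below-shift le)))
  where gap = trans (sym (diffMod-> k i j c ei)) (trans e (diffMod-≤ k i' j i'≤j))

diffMod-self : ∀ k (i : Fin (suc k)) → diffMod (suc k) i i ≡ 0
diffMod-self k i = trans (diffMod-≤ k i i ≤-refl) (n∸n≡0 (toℕ i))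

diffMod-sucF : ∀ k (j : Fin (suc k)) → diffMod (suc k) (sucF j) j ≡ k
diffMod-sucF k j with toℕ-sucF j
... | inj₁ (_ , e) = diffMod-> k (sucF j) j 0 (trans e (sym (trans (+-suc (toℕ j) 0) (cong suc (+-identityʳ (toℕ j))))))
... | inj₂ (e₁ , e₂) = trans (diffMod-≤ k (sucF j) j (subst (_≤ toℕ j) (sym e₂) z≤n))
                             (trans (cong (toℕ j ∸_) e₂) (suc-injective e₁))

Successor-fixpoint : ∀ {N a} → Successor N a a → N ≤ 1
Successor-fixpoint (inj₁ (_ , e)) = ⊥-elim (<-irrefl e (n<1+n _))
Successor-fixpoint (inj₂ (e₁ , refl)) = subst (_≤ 1) e₁ ≤-refl

Successor-2-cycle : ∀ {N a b} → Successor N a b → Successor N b a → N ≤ 2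
Successor-2-cycle (inj₁ (_ , refl)) (inj₁ (_ , e)) = ⊥-elim (<-irrefl e (≤-trans (n<1+n _) (n≤1+n _)))
Successor-2-cycle (inj₁ (_ , refl)) (inj₂ (e₁ , refl)) = subst (_≤ 2) e₁ ≤-refl
Successor-2-cycle (inj₂ (e₁ , refl)) (inj₁ (_ , refl)) = subst (_≤ 2) e₁ ≤-refl
Successor-2-cycle (inj₂ (e₁ , refl)) (inj₂ (_ , refl)) = subst (_≤ 2) e₁ (n≤1+n 1)

sucF-no-fixpoint : ∀ {N} → 2 ≤ N → (x : Fin N) → sucF x ≢ x
sucF-no-fixpoint 2≤N x e =
  <-irrefl refl (≤-trans 2≤N (Successor-fixpoint (subst (λ t → Successor _ (toℕ x) (toℕ t)) e (toℕ-sucF x))))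

sucF²-no-fixpoint : ∀ {N} → 3 ≤ N → (x : Fin N) → sucF (sucF x) ≢ x
sucF²-no-fixpoint 3≤N x e = <-irrefl refl (≤-trans 3≤N (Successor-2-cycle (toℕ-sucF x)
  (subst (λ t → Successor _ (toℕ (sucF x)) (toℕ t)) e (toℕ-sucF (sucF x)))))

module SucClosed {N : ℕ} (P : Fin N → Bool) (closed : ∀ x → P x ≡ true → P (sucF x) ≡ true) where

  climb : ∀ d (x y : Fin N) → toℕ y ≡ toℕ x + d → P x ≡ true → P y ≡ true
  climb zero x y e px = subst (λ t → P t ≡ true) (toℕ-injective (trans (sym (+-identityʳ (toℕ x))) (sym e))) px
  climb (suc d) x F.zero e px with trans e (+-suc (toℕ x) d)
  ... | ()
  climb (suc d) x (F.suc y) e px = subst (λ t → P t ≡ true) (sym suc-y) (closed y' (climb d x y' y'≡x+d px))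
    where
    y' = F.inject₁ y
    y'≡x+d : toℕ y' ≡ toℕ x + d
    y'≡x+d = trans (FP.toℕ-inject₁ y) (suc-injective (trans e (+-suc (toℕ x) d)))
    suc-y : F.suc y ≡ sucF y'
    suc-y = Successor⇒sucF (F.suc y) y'
      (inj₁ (subst (λ t → suc t < N) (sym (FP.toℕ-inject₁ y)) (toℕ<n (F.suc y)) , cong suc (sym (FP.toℕ-inject₁ y))))

-- from p climb to the last element, wrap around to zero, and climb to q
sucF-closed-full : ∀ {N} (P : Fin N → Bool) → (∀ x → P x ≡ true → P (sucF x) ≡ true) →
  ∀ p q → P p ≡ true → P q ≡ true
sucF-closed-full {suc N'} P closed p q pp = climb (toℕ q) F.zero q refl P-zero
  where
  open SucClosed P closed
  last = F.fromℕ N'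
  P-last : P last ≡ true
  P-last = climb (N' ∸ toℕ p) p last (trans (FP.toℕ-fromℕ N') (sym (m+[n∸m]≡n (≤-pred (toℕ<n p))))) pp
  P-zero : P F.zero ≡ true
  P-zero = subst (λ t → P t ≡ true)
    (sym (Successor⇒sucF F.zero last (inj₂ (cong suc (FP.toℕ-fromℕ N') , refl)))) (closed last P-last)

sucF-leaves : ∀ {N} (P : Fin N → Bool) p q → P p ≡ true → P q ≡ false → ∃ λ x → (P x ≡ true) × (P (sucF x) ≡ false)
sucF-leaves P p q pp pq with FP.any? (λ x → (P x ∧ not (P (sucF x))) Bool.≟ true)
... | yes (x , e) = x , proj₁ (∧-elim (P x) e) , not-elim _ (proj₂ (∧-elim (P x) e))
... | no none = ⊥-elim (bool-clash pq (sucF-closed-full P closed p q pp))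
  where
  closed : ∀ x → P x ≡ true → P (sucF x) ≡ true
  closed x px with b-cases (P (sucF x))
  ... | inj₁ r = r
  ... | inj₂ r = ⊥-elim (none (x , ∧-intro px (not-intro r)))

OmitsZeroAndMinusOne : ℕ → (ℕ → Bool) → Set
OmitsZeroAndMinusOne k J = ∀ d → d < suc k → (J d ≡ false) ⇔ ((d ≡ 0) ⊎ (d ≡ k))

-- Such a circulant is the complement of the cycle i+1 → i: i ↛ j iff
-- (j - i) mod (k + 1) is 0 or -1, i.e. iff i = j or i = j + 1.
circulant-cycle-complement : ∀ k J → OmitsZeroAndMinusOne k J → 3 ≤ suc k → CycleComplement (Circulant (suc k) J)
circulant-cycle-complement k J omits 3≤N = record
  { σ = sucF
  ; non-arc⇒ = non-arc⇒
  ; non-arc⇐ = non-arc⇐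
  ; σ-injective = sucF-injective
  ; σ-no-fixpoint = sucF-no-fixpoint (≤-trans (n≤1+n 2) 3≤N)
  ; σ²-no-fixpoint = sucF²-no-fixpoint 3≤N
  ; σ-leaves = sucF-leaves
  ; base = F.zero
  }
  where
  residue-bound : ∀ i j → diffMod (suc k) i j < suc k
  residue-bound i j = m%n<n ((toℕ j + suc k) ∸ toℕ i) (suc k)
  non-arc⇒ : ∀ i j → J (diffMod (suc k) i j) ≡ false → (i ≡ j) ⊎ (i ≡ sucF j)
  non-arc⇒ i j no-arc with Equivalence.to (omits _ (residue-bound i j)) no-arc
  ... | inj₁ d≡0 = inj₁ (diffMod-injective k i j j (trans d≡0 (sym (diffMod-self k j))))
  ... | inj₂ d≡k = inj₂ (diffMod-injective k i (sucF j) j (trans d≡k (sym (diffMod-sucF k j))))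
  non-arc⇐ : ∀ i j → (i ≡ j) ⊎ (i ≡ sucF j) → J (diffMod (suc k) i j) ≡ false
  non-arc⇐ i .i (inj₁ refl) = Equivalence.from (omits _ (residue-bound i i)) (inj₁ (diffMod-self k i))
  non-arc⇐ .(sucF j) j (inj₂ refl) = Equivalence.from (omits _ (residue-bound (sucF j) j)) (inj₂ (diffMod-sucF k j))

C3-omits : OmitsZeroAndMinusOne 2 (λ d → d ≡ᵇ 1)
C3-omits zero _ = mk⇔ (λ _ → inj₁ refl) (λ _ → refl)
C3-omits (suc zero) _ = mk⇔ (λ ()) (λ { (inj₁ ()) ; (inj₂ ()) })
C3-omits (suc (suc zero)) _ = mk⇔ (λ _ → inj₂ refl) (λ _ → refl)
C3-omits (suc (suc (suc d))) (s≤s (s≤s (s≤s ())))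

double : ∀ x → x * 2 ≡ x + x
double x = trans (*-comm x 2) (cong (x +_) (+-identityʳ x))

m≤2[m/2]+1 : ∀ m → m ≤ suc (m / 2 + m / 2)
m≤2[m/2]+1 m = begin
  m                        ≡⟨ m≡m%n+[m/n]*n m 2 ⟩
  m % 2 + (m / 2) * 2      ≤⟨ +-monoˡ-≤ ((m / 2) * 2) (≤-pred (m%n<n m 2)) ⟩
  1 + (m / 2) * 2          ≡⟨ cong suc (double (m / 2)) ⟩
  suc (m / 2 + m / 2)      ∎
  where open ≤-Reasoning

≤⇒≤ᵇ≡true : ∀ {a b} → a ≤ b → (a ≤ᵇ b) ≡ true
≤⇒≤ᵇ≡true le = Equivalence.to T-≡ (≤⇒≤ᵇ le)

-- Jm m contains every residue 1 ≤ d ≤ m - 2: either d ≤ ⌊m/2⌋, or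
-- 2 ≤ m - d ≤ ⌊m/2⌋ and d ≡ -(m - d).
Jm-inner : ∀ m d → 1 ≤ d → suc d < m → Jm m d ≡ true
Jm-inner m (suc zero) _ _ = refl
Jm-inner m d@(suc (suc _)) _ d+1<m with d ≤? m / 2
... | yes d≤m/2 = ∨-introʳ false (∨-introˡ (∧-intro refl (≤⇒≤ᵇ≡true d≤m/2)))
... | no d≰m/2 = ∨-introʳ false (∨-introʳ ((d ≤ᵇ m / 2)) (∧-intro refl (∧-intro (≤⇒≤ᵇ≡true 2≤m-d) (≤⇒≤ᵇ≡true m-d≤m/2))))
  where
  2≤m-d : 2 ≤ m ∸ d
  2≤m-d = subst (_≤ m ∸ d) (m+n∸n≡m 2 d) (∸-monoˡ-≤ d d+1<m)
  m-d≤m/2 : m ∸ d ≤ m / 2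
  m-d≤m/2 = subst (m ∸ d ≤_) (m+n∸n≡m (m / 2) d) (∸-monoˡ-≤ d (≤-trans (m≤2[m/2]+1 m)
              (subst (_≤ m / 2 + d) (+-suc (m / 2) (m / 2)) (+-monoʳ-≤ (m / 2) (≰⇒> d≰m/2)))))

-- ... but not the residue m - 1 ≡ -1, as m - 1 > ⌊m/2⌋ and m - (m - 1) = 1.
last-above-half : ∀ r → ((3 + r) ≤ᵇ (4 + r) / 2) ≡ false
last-above-half r with b-cases ((3 + r) ≤ᵇ (4 + r) / 2)
... | inj₂ f = f
... | inj₁ t = ⊥-elim (<-irrefl refl (<-≤-trans m<2[m-1] (≤-trans (+-mono-≤ le le) 2[m/2]≤m)))
  where
  le : 3 + r ≤ (4 + r) / 2
  le = ≤ᵇ⇒≤ (3 + r) ((4 + r) / 2) (Equivalence.from T-≡ t)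
  2[m/2]≤m : (4 + r) / 2 + (4 + r) / 2 ≤ 4 + r
  2[m/2]≤m = subst (_≤ 4 + r) (double ((4 + r) / 2)) (m/n*n≤m (4 + r) 2)
  m<2[m-1] : 4 + r < (3 + r) + (3 + r)
  m<2[m-1] = s≤s (s≤s (s≤s (≤-trans (n≤1+n (2 + r)) (m≤n+m (3 + r) r))))

Jm-last : ∀ r → Jm (4 + r) (3 + r) ≡ false
Jm-last r rewrite last-above-half r | m+n∸n≡m 1 r = refl

Cm-omits : ∀ r → OmitsZeroAndMinusOne (3 + r) (Jm (4 + r))
Cm-omits r zero _ = mk⇔ (λ _ → inj₁ refl) (λ _ → refl)
Cm-omits r (suc d) d<m with suc (suc d) <? 4 + r
... | yes d+1<m = mk⇔ (λ e → ⊥-elim (bool-clash e (Jm-inner (4 + r) (suc d) (s≤s z≤n) d+1<m))) omitted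
  where
  omitted : (suc d ≡ 0) ⊎ (suc d ≡ 3 + r) → Jm (4 + r) (suc d) ≡ false
  omitted (inj₁ ())
  omitted (inj₂ refl) = ⊥-elim (<-irrefl refl d+1<m)
... | no d+1≮m = mk⇔ (λ _ → inj₂ d≡m-1) (λ _ → subst (λ t → Jm (4 + r) t ≡ false) (sym d≡m-1) (Jm-last r))
  where
  d≡m-1 : suc d ≡ 3 + r
  d≡m-1 = suc-injective (≤-antisym d<m (≮⇒≥ d+1≮m))

C3-cycle-complement : CycleComplement C3
C3-cycle-complement = circulant-cycle-complement 2 (λ d → d ≡ᵇ 1) C3-omits ≤-refl

Cm-cycle-complement : ∀ r → CycleComplement (Cm (4 + r))
Cm-cycle-complement r = circulant-cycle-complement (3 + r) (Jm (4 + r)) (Cm-omits r) (s≤s (s≤s (s≤s z≤n)))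

cycle-complement-classification : ∀ {D} → CycleComplement D → (D ≅ C3) ⊎ (∃ λ m → (4 ≤ m) × (D ≅ Cm m))
cycle-complement-classification {D} c with n D ≟ℕ 3
... | yes n≡3 = inj₁ (cycle-complements-isomorphic c C3-cycle-complement n≡3)
... | no n≢3 = inj₂ (4 + r , s≤s (s≤s (s≤s (s≤s z≤n))) , cycle-complements-isomorphic c (Cm-cycle-complement r) n≡4+r)
  where
  r = n D ∸ 4
  n≡4+r : n D ≡ 4 + r
  n≡4+r = sym (trans (+-comm 4 r) (m∸n+n≡m (≤∧≢⇒< (Orbit.order≥3 c) (λ e → n≢3 (sym e)))))

CKI⇒cycle-complement : (D : Digraph) → Loopless D → SemicompleteMultipartite D ⊎ QuasiTransitive D →
  CKI D → CycleComplement D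
CKI⇒cycle-complement D loopless class (no-kernel , H) =
  SemicompleteCKI.cycle-complement D loopless (semicomplete class) H no-kernel
  where
  semicomplete : SemicompleteMultipartite D ⊎ QuasiTransitive D → Semicomplete D
  semicomplete (inj₁ smp) = MultipartiteCKI.semicomplete D smp H no-kernel
  semicomplete (inj₂ qt) = QuasiTransitiveCKI.semicomplete D loopless qt H no-kernel

corollary1 : (D : Digraph) → Loopless D →
    SemicompleteMultipartite D ⊎ QuasiTransitive D →
    CKI D ⇔ ((D ≅ C3) ⊎ (∃ λ m → (4 ≤ m) × (D ≅ Cm m)))
corollary1 D loopless class =
  mk⇔ (λ cki → cycle-complement-classification (CKI⇒cycle-complement D loopless class cki)) target⇒CKI
  where
  target⇒CKI : (D ≅ C3) ⊎ (∃ λ m → (4 ≤ m) × (D ≅ Cm m)) → CKI D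
  target⇒CKI (inj₁ iso) = cycle-complement-CKI (transport iso C3-cycle-complement)
  target⇒CKI (inj₂ (suc (suc (suc (suc r))) , s≤s (s≤s (s≤s (s≤s _))) , iso)) = cycle-complement-CKI (transport iso (Cm-cycle-complement r))
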